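{- For every pattern $\alpha\in(\Sigma\cup\Xi)^*$, the erasing pattern language $\mathcal{L}_{E}(\alpha)$ can be maintained in $\mathsf{DynCQ}$.
   Context: Patterns. $\Sigma$ is a finite alphabet and $\Xi$ an infinite set of variables disjoint from $\Sigma$. A pattern is a word over $\Sigma\cup\Xi$. A substitution is a morphism $\sigma:(\Sigma\cup\Xi)^*\to\Sigma^*$ with $\sigma(a)=a$ for $a\in\Sigma$. The erasing language of $\alpha$ is $\mathcal{L}_{E}(\alpha)=\{\sigma(\alpha):\sigma$ a substitution$\}$ (variables may be mapped to $\varepsilon$). Dynamic setting. A word-structure has domain $D=\{1,\dots,n+1\}$ ($n\ge0$), the linear order $<$, a constant $\$=n+1$, and for each $\zeta\in\Sigma$ a unary relation $R_\zeta\subseteq\{1,\dots,n\}$, each position in at most one $R_\zeta$. Write $w(i)=\zeta$ if $R_\zeta(i)$ and $w(i)=\varepsilon$ otherwise; the current word is $w=w(1)\cdots w(n)$. Updates $\mathsf{ins}_\zeta(i)$ (set $w(i)=\zeta$) and $\mathsf{reset}(i)$ (set $w(i)=\varepsilon$), $i\le n$, are allowed only if they change the word-structure; initially all positions are $\varepsilon$. A dynamic program has finitely many auxiliary relations over $D$ (possibly 0-ary), initialized by first-order formulas, and for each auxiliary relation $R$ (arity $k$) and each abstract update $\mathsf{op}$ an update formula $\varphi^R_{\mathsf{op}}(y;x_1,\dots,x_k)$; after applying $\mathsf{op}$ at $i$, the new $R$ is the set of $\vec j$ with $\varphi^R_{\mathsf{op}}(i;\vec j)$ true in the updated word-structure with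 the old auxiliary relations. A program maintains a language $L$ if a designated 0-ary auxiliary relation is true exactly when the current word is in $L$, after every sequence of updates. $\mathsf{DynCQ}$: all update formulas are conjunctive queries (built from atoms by conjunction and existential quantification). -}

module Defs where

open import Data.Nat using (ℕ; zero; suc)
open import Data.Fin using (Fin; zero; suc; fromℕ; inject₁) renaming (_<_ to _<ᶠ_)
open import Data.Vec using (Vec; []; _∷_; map)
open import Data.List using (List; []; _∷_; [_]; concatMap; catMaybes; tabulate)
open import Data.Maybe using (Maybe; just; nothing)
open import Data.Sum using (_⊎_; inj₁; inj₂)
open import Data.Product using (Σ; _×_; _,_; ∃)
open import Data.Empty using (⊥)
open import Relation.Nullary using (¬_)
open import Relation.Binary.PropositionalEquality using (_≡_; _≢_; subst; sym)
open import Function.Bundles using (_⇔_)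

-- Patterns and erasing pattern languages.
-- The finite alphabet Σ is Fin s; the infinite variable set Ξ is ℕ.

Pattern : ℕ → Set
Pattern s = List (Fin s ⊎ ℕ)

applySubst : {s : ℕ} → (ℕ → List (Fin s)) → Pattern s → List (Fin s)
applySubst {s} σ = concatMap f
  where
  f : Fin s ⊎ ℕ → List (Fin s)
  f (inj₁ a) = [ a ]
  f (inj₂ x) = σ x

ErasingLang : {s : ℕ} → Pattern s → List (Fin s) → Set
ErasingLang {s} α w = Σ (ℕ → List (Fin s)) λ σ → applySubst σ α ≡ w

data Term (v : ℕ) : Set where
  var    : Fin v → Term v
  dollar : Term v            -- the constant $ = n+1 (the maximal element)

data FO (s : ℕ) {m : ℕ} (ar : Fin m → ℕ) (v : ℕ) : Set where
  eq     : Term v → Term v → FO s ar v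
  lt     : Term v → Term v → FO s ar v
  letter : Fin s → Term v → FO s ar v
  aux    : (r : Fin m) → Vec (Term v) (ar r) → FO s ar v
  neg    : FO s ar v → FO s ar v
  and    : FO s ar v → FO s ar v → FO s ar v
  ex     : FO s ar (suc v) → FO s ar v             -- ∃ binding de Bruijn index zero

data IsCQ {s m : ℕ} {ar : Fin m → ℕ} : {v : ℕ} → FO s ar v → Set where
  eq     : ∀ {v} (t u : Term v) → IsCQ (eq t u)
  lt     : ∀ {v} (t u : Term v) → IsCQ (lt t u)
  letter : ∀ {v} ζ (t : Term v) → IsCQ (letter ζ t)
  aux    : ∀ {v} r (ts : Vec (Term v) (ar r)) → IsCQ (aux r ts)
  and    : ∀ {v} {φ ψ : FO s ar v} → IsCQ φ → IsCQ ψ → IsCQ (and φ ψ)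
  ex     : ∀ {v} {φ : FO s ar (suc v)} → IsCQ φ → IsCQ (ex φ)

-- Word structures. Domain D = Fin (suc n) (elements 1..n+1 as 0..n);
-- positions 1..n are Fin n, embedded via inject₁; $ = fromℕ n.
-- The word part is w : Fin n → Maybe (Fin s) (nothing = ε).

Word : ℕ → ℕ → Set
Word s n = Fin n → Maybe (Fin s)

-- Letter at a domain element ($ carries no letter).
wAt : {s n : ℕ} → Word s n → Fin (suc n) → Maybe (Fin s)
wAt {n = zero}  w zero    = nothing
wAt {n = suc n} w zero    = w zero
wAt {n = suc n} w (suc d) = wAt (λ i → w (suc i)) d

currentWord : {s n : ℕ} → Word s n → List (Fin s)
currentWord {n = n} w = catMaybes (tabulate w)

AuxVal : {m : ℕ} → (Fin m → ℕ) → ℕ → Set₁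
AuxVal {m} ar n = (r : Fin m) → Vec (Fin (suc n)) (ar r) → Set

evalT : {n v : ℕ} → (Fin v → Fin (suc n)) → Term v → Fin (suc n)
evalT ρ (var x) = ρ x
evalT {n} ρ dollar = fromℕ n

extend : {n v : ℕ} → Fin (suc n) → (Fin v → Fin (suc n)) → Fin (suc v) → Fin (suc n)
extend d ρ zero    = d
extend d ρ (suc x) = ρ x

⟦_⟧ : {s m : ℕ} {ar : Fin m → ℕ} {v : ℕ} → FO s ar v →
      {n : ℕ} → Word s n → AuxVal ar n → (Fin v → Fin (suc n)) → Set
⟦ eq t u ⟧     w A ρ = evalT ρ t ≡ evalT ρ u
⟦ lt t u ⟧     w A ρ = evalT ρ t <ᶠ evalT ρ u
⟦ letter ζ t ⟧ w A ρ = wAt w (evalT ρ t) ≡ just ζ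
⟦ aux r ts ⟧   w A ρ = A r (map (evalT ρ) ts)
⟦ neg φ ⟧      w A ρ = ¬ ⟦ φ ⟧ w A ρ
⟦ and φ ψ ⟧    w A ρ = ⟦ φ ⟧ w A ρ × ⟦ ψ ⟧ w A ρ
⟦ ex φ ⟧ {n}   w A ρ = Σ (Fin (suc n)) λ d → ⟦ φ ⟧ w A (extend d ρ)

lookupV : {A : Set} {k : ℕ} → Vec A k → Fin k → A
lookupV (x ∷ xs) zero    = x
lookupV (x ∷ xs) (suc i) = lookupV xs i

data Op (s : ℕ) : Set where
  insOp   : Fin s → Op s
  resetOp : Op s

data Update (s n : ℕ) : Set where
  ins   : Fin s → Fin n → Update s n
  reset : Fin n → Update s n

opOf : {s n : ℕ} → Update s n → Op s
opOf (ins ζ i) = insOp ζ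
opOf (reset i) = resetOp

posOf : {s n : ℕ} → Update s n → Fin n
posOf (ins ζ i) = i
posOf (reset i) = i

-- An update is allowed only if it changes the word structure:
-- ins_ζ(i) inserts i into R_ζ (i must be in no R_ζ' by the invariant),
-- reset(i) removes i from the relation containing it.
Allowed : {s n : ℕ} → Word s n → Update s n → Set
Allowed w (ins ζ i) = w i ≡ nothing
Allowed w (reset i) = w i ≢ nothing

setAt : {s n : ℕ} → Word s n → Fin n → Maybe (Fin s) → Word s n
setAt {n = suc n} w zero    a zero    = a
setAt {n = suc n} w zero    a (suc j) = w (suc j)
setAt {n = suc n} w (suc i) a zero    = w zero
setAt {n = suc n} w (suc i) a (suc j) = setAt (λ k → w (suc k)) i a j

applyU : {s n : ℕ} → Word s n → Update s n → Word s n
applyU w (ins ζ i) = setAt w i (just ζ)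
applyU w (reset i) = setAt w i nothing

noAux : Fin 0 → ℕ
noAux ()

noAuxVal : (n : ℕ) → AuxVal noAux n
noAuxVal n ()

record DynProgram (s : ℕ) : Set where
  field
    m      : ℕ
    arity  : Fin m → ℕ
    init   : (r : Fin m) → FO s noAux (arity r)
    -- update formulas φ^R_op(y; x_1,…,x_k): variable zero is y
    upd    : (r : Fin m) → Op s → FO s arity (suc (arity r))
    acc    : Fin m
    accAr  : arity acc ≡ 0

IsDynCQ : {s : ℕ} → DynProgram s → Set
IsDynCQ P = ∀ r op → IsCQ (DynProgram.upd P r op)

module _ {s : ℕ} (P : DynProgram s) where
  open DynProgram P

  State : ℕ → Set₁
  State n = Word s n × AuxVal arity n

  emptyWord : (n : ℕ) → Word s n
  emptyWord n i = nothing

  initState : (n : ℕ) → State n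
  initState n = emptyWord n ,
    λ r xs → ⟦ init r ⟧ (emptyWord n) (noAuxVal n) (lookupV xs)

  step : {n : ℕ} → State n → Update s n → State n
  step (w , A) u = applyU w u ,
    λ r xs → ⟦ upd r (opOf u) ⟧ (applyU w u) A (lookupV (inject₁ (posOf u) ∷ xs))

  data Reachable {n : ℕ} : State n → Set₁ where
    start : Reachable (initState n)
    next  : ∀ {st} (u : Update s n) → Reachable st →
            Allowed (Data.Product.proj₁ st) u → Reachable (step st u)

  accepts : {n : ℕ} → State n → Set
  accepts (w , A) = A acc (subst (Vec (Fin _)) (sym accAr) [])

  Maintains : (List (Fin s) → Set) → Set₁
  Maintains L = ∀ n (st : State n) → Reachable st →
                accepts st ⇔ L (currentWord (Data.Product.proj₁ st))

MaintainableInDynCQ : {s : ℕ} → (List (Fin s) → Set) → Set₁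
MaintainableInDynCQ {s} L =
  Σ (DynProgram s) λ P → IsDynCQ P × Maintains P L

module Submission where

-- Writing EQ(a, b, c, d) for a ≤ b ≤ c ≤ d ∧ w[a, b) = w[c, d), the program maintains EQ by a
-- conjunctive update formula. A change at position y touches at most one of the two factors; the
-- three possibilities (y in neither, in the first or in the second factor) are not told apart by a
-- disjunction but precomputed in a static selector relation, which fixes the arguments of two old
-- EQ-atoms and the position e of the other factor that corresponds to y. Membership in L_E(α) is a
-- conjunctive query over EQ: cut the word into the blocks of α, a terminal block being one letter
-- between empty factors and each repeated variable carrying the factor of its first occurrence.
-- After an update the acceptance bit is this query with the update formula of EQ substituted for
-- EQ. Order, successor and minimum, which a conjunctive query cannot express, are static relations
-- initialised by first-order formulas.

open import Data.Empty using (⊥; ⊥-elim)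
open import Data.Fin using (Fin; zero; suc; toℕ; fromℕ<; inject₁; #_) renaming (_<_ to _<ᶠ_)
open import Data.Fin.Properties using (toℕ-injective; toℕ<n; toℕ-fromℕ<; toℕ-fromℕ; toℕ-inject₁; any?)
  renaming (_≟_ to _≟ᶠ_; _<?_ to _<ᶠ?_)
open import Data.List using (List; []; _∷_; [_]; _++_; fromMaybe)
open import Data.List.Properties using (++-assoc; ++-identityʳ; ++-conicalʳ; ∷-injective)
open import Data.Maybe using (Maybe; just; nothing)
import Data.Maybe.Properties as Maybe
open import Data.Nat using (ℕ; zero; suc; _+_; _∸_; _≤_; _<_; _≟_; _≤?_; _<?_; z≤n; s≤s; z<s)
open import Data.Nat.Properties
open import Data.Product using (∃-syntax; _×_; _,_; proj₁; proj₂)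
open import Data.Product.Function.NonDependent.Propositional using (_×-⇔_)
open import Data.Sum using (_⊎_; inj₁; inj₂)
open import Data.Unit using (⊤; tt)
open import Data.Vec using (Vec; []; _∷_; map; tabulate)
open import Function using (_∘_)
open import Function.Bundles using (_⇔_; mk⇔; Equivalence)
import Function.Properties.Equivalence as ⇔
open import Function.Related.Propositional using (≡⇒; equivalence)
open import Function.Related.TypeIsomorphisms using (¬-cong-⇔)
open import Relation.Binary.PropositionalEquality hiding ([_])
open import Relation.Nullary using (¬_; yes; no)
open import Relation.Nullary.Decidable using (Dec; _×-dec_; ¬?)

open import Defs

open Equivalence using (to; from)

≡⇒⇔ : ∀ {A B : Set} → A ≡ B → A ⇔ B
≡⇒⇔ = ≡⇒ {k = equivalence}

toℕ-onto : ∀ {m k} → k < m → ∃[ K ] toℕ {m} K ≡ k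
toℕ-onto k<m = fromℕ< k<m , toℕ-fromℕ< k<m

infix 4 _∈[_,_⟩
_∈[_,_⟩ : ℕ → ℕ → ℕ → Set
y ∈[ a , b ⟩ = a ≤ y × y < b

Chain : ℕ → ℕ → ℕ → ℕ → Set
Chain a b c d = a ≤ b × b ≤ c × c ≤ d

_∈[_,_⟩? : ∀ y a b → Dec (y ∈[ a , b ⟩)
y ∈[ a , b ⟩? = a ≤? y ×-dec y <? b

<⇒∉ : ∀ {y a b} → y < a → ¬ y ∈[ a , b ⟩
<⇒∉ y<a (a≤y , _) = <⇒≱ y<a a≤y

≥⇒∉ : ∀ {y a b} → b ≤ y → ¬ y ∈[ a , b ⟩
≥⇒∉ b≤y (_ , y<b) = <⇒≱ y<b b≤y

-- Factors of a word

module _ {s : ℕ} where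

  letterAt : ∀ {n} → Word s n → ℕ → Maybe (Fin s)
  letterAt {zero}  w j       = nothing
  letterAt {suc n} w zero    = w zero
  letterAt {suc n} w (suc j) = letterAt (λ i → w (suc i)) j

  segment : ∀ {n} → Word s n → ℕ → ℕ → List (Fin s)
  segment w a zero    = []
  segment w a (suc k) = fromMaybe (letterAt w a) ++ segment w (suc a) k

  -- The factor w[a, b) of the current word, positions counted from 0; it is [] whenever b ≤ a.
  factor : ∀ {n} → Word s n → ℕ → ℕ → List (Fin s)
  factor w a b = segment w a (b ∸ a)

  letterAt-setAt-≡ : ∀ {n} (w : Word s n) i x → letterAt (setAt w i x) (toℕ i) ≡ x
  letterAt-setAt-≡ {suc n} w zero    x = refl
  letterAt-setAt-≡ {suc n} w (suc i) x = letterAt-setAt-≡ (λ k → w (suc k)) i x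

  letterAt-setAt-≢ : ∀ {n} (w : Word s n) i x j → j ≢ toℕ i → letterAt (setAt w i x) j ≡ letterAt w j
  letterAt-setAt-≢ {suc n} w zero    x zero    j≢i = ⊥-elim (j≢i refl)
  letterAt-setAt-≢ {suc n} w zero    x (suc j) j≢i = refl
  letterAt-setAt-≢ {suc n} w (suc i) x zero    j≢i = refl
  letterAt-setAt-≢ {suc n} w (suc i) x (suc j) j≢i = letterAt-setAt-≢ (λ k → w (suc k)) i x j (j≢i ∘ cong suc)

  letterAt-just⇒< : ∀ {n} (w : Word s n) j {x} → letterAt w j ≡ just x → j < n
  letterAt-just⇒< {suc n} w zero    _ = s≤s z≤n
  letterAt-just⇒< {suc n} w (suc j) h = s≤s (letterAt-just⇒< (λ i → w (suc i)) j h)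

  wAt≡letterAt : ∀ {n} (w : Word s n) d → wAt w d ≡ letterAt w (toℕ d)
  wAt≡letterAt {zero}  w zero    = refl
  wAt≡letterAt {suc n} w zero    = refl
  wAt≡letterAt {suc n} w (suc d) = wAt≡letterAt (λ i → w (suc i)) d

  letterAt-empty : ∀ {n} j → letterAt {n} (λ _ → nothing) j ≡ nothing
  letterAt-empty {zero}  j       = refl
  letterAt-empty {suc n} zero    = refl
  letterAt-empty {suc n} (suc j) = letterAt-empty {n} j

  segment-tail : ∀ {n} (w : Word s (suc n)) a k → segment w (suc a) k ≡ segment (λ i → w (suc i)) a k
  segment-tail w a zero    = refl
  segment-tail w a (suc k) = cong (fromMaybe (letterAt (λ i → w (suc i)) a) ++_) (segment-tail w (suc a) k)

  currentWord≡factor : ∀ {n} (w : Word s n) → currentWord w ≡ factor w 0 n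
  currentWord≡factor {zero}  w = refl
  currentWord≡factor {suc n} w with w zero
  ... | just x  = cong (x ∷_) (trans (currentWord≡factor (λ i → w (suc i))) (sym (segment-tail w 0 n)))
  ... | nothing = trans (currentWord≡factor (λ i → w (suc i))) (sym (segment-tail w 0 n))

  module _ {n : ℕ} (w : Word s n) where

    segment-++ : ∀ a k l → segment w a (k + l) ≡ segment w a k ++ segment w (a + k) l
    segment-++ a zero    l rewrite +-identityʳ a = refl
    segment-++ a (suc k) l rewrite +-suc a k =
      trans (cong (fromMaybe (letterAt w a) ++_) (segment-++ (suc a) k l))
            (sym (++-assoc (fromMaybe (letterAt w a)) _ _))

    factor-+ : ∀ a k → factor w a (a + k) ≡ segment w a k
    factor-+ a k = cong (segment w a) (m+n∸m≡n a k)

    factor-self : ∀ a → factor w a a ≡ []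
    factor-self a rewrite n∸n≡0 a = refl

    factor-suc : ∀ a → factor w a (suc a) ≡ fromMaybe (letterAt w a)
    factor-suc a rewrite m+n∸n≡m 1 a = ++-identityʳ _

    factor-split : ∀ {a b c} → a ≤ b → b ≤ c → factor w a c ≡ factor w a b ++ factor w b c
    factor-split {a} {b} {c} a≤b b≤c with m≤n⇒∃[o]m+o≡n {a} {b} a≤b | m≤n⇒∃[o]m+o≡n {b} {c} b≤c
    ... | k , refl | l , refl = begin
      factor w a (a + k + l)                              ≡⟨ cong (factor w a) (+-assoc a k l) ⟩
      factor w a (a + (k + l))                            ≡⟨ factor-+ a (k + l) ⟩
      segment w a (k + l)                                 ≡⟨ segment-++ a k l ⟩
      segment w a k ++ segment w (a + k) l                ≡⟨ sym (cong₂ _++_ (factor-+ a k) (factor-+ (a + k) l)) ⟩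
      factor w a (a + k) ++ factor w (a + k) (a + k + l)  ∎
      where open ≡-Reasoning

    factor-step : ∀ {a b} → a < b → factor w a b ≡ fromMaybe (letterAt w a) ++ factor w (suc a) b
    factor-step {a} {b} a<b = trans (factor-split (n≤1+n a) a<b) (cong (_++ factor w (suc a) b) (factor-suc a))

    factor-around : ∀ {a e b} → a ≤ e → e < b →
                    factor w a b ≡ factor w a e ++ fromMaybe (letterAt w e) ++ factor w (suc e) b
    factor-around a≤e e<b = trans (factor-split a≤e (<⇒≤ e<b)) (cong (_ ++_) (factor-step e<b))

    factor-cons : ∀ {a b m u} → letterAt w a ≡ m → a < b → factor w (suc a) b ≡ u →
                  factor w a b ≡ fromMaybe m ++ u
    factor-cons at-a a<b f = trans (factor-step a<b) (cong₂ (λ m u → fromMaybe m ++ u) at-a f)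

    Split : ℕ → ℕ → List (Fin s) → List (Fin s) → Set
    Split a c u v = ∃[ b ] a ≤ b × b ≤ c × factor w a b ≡ u × factor w b c ≡ v

    SplitAround : ℕ → ℕ → List (Fin s) → Fin s → List (Fin s) → Set
    SplitAround a c u x v = ∃[ e ] a ≤ e × e < c × factor w a e ≡ u × letterAt w e ≡ just x × factor w (suc e) c ≡ v

    private
      Split-cons : ∀ {a k m u v} → letterAt w a ≡ m →
                   Split (suc a) (suc a + k) u v → Split a (a + suc k) (fromMaybe m ++ u) v
      Split-cons {a} {k} at-a (b , a<b , b≤ , f₁ , f₂) rewrite +-suc a k =
        b , <⇒≤ a<b , b≤ , factor-cons at-a a<b f₁ , f₂

    segment-++⁻ : ∀ a k u v → segment w a k ≡ u ++ v → Split a (a + k) u v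
    segment-++⁻ a k [] v h = a , ≤-refl , m≤m+n a k , factor-self a , trans (factor-+ a k) h
    segment-++⁻ a (suc k) (x ∷ u) v h with letterAt w a in at-a
    ... | nothing = Split-cons at-a (segment-++⁻ (suc a) k (x ∷ u) v h)
    ... | just y with ∷-injective h
    ...   | refl , h′ = Split-cons at-a (segment-++⁻ (suc a) k u v h′)

    private
      SplitAround-cons : ∀ {a k m u x v} → letterAt w a ≡ m →
                         SplitAround (suc a) (suc a + k) u x v → SplitAround a (a + suc k) (fromMaybe m ++ u) x v
      SplitAround-cons {a} {k} at-a (e , a<e , e< , f₁ , at-e , f₂) rewrite +-suc a k =
        e , <⇒≤ a<e , e< , factor-cons at-a a<e f₁ , at-e , f₂

    segment-++-∷⁻ : ∀ a k u x v → segment w a k ≡ u ++ x ∷ v → SplitAround a (a + k) u x v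
    segment-++-∷⁻ a zero    []      x v ()
    segment-++-∷⁻ a zero    (_ ∷ _) x v ()
    segment-++-∷⁻ a (suc k) u x v h with letterAt w a in at-a
    segment-++-∷⁻ a (suc k) u x v h | nothing = SplitAround-cons at-a (segment-++-∷⁻ (suc a) k u x v h)
    segment-++-∷⁻ a (suc k) [] x v h | just y with ∷-injective h
    ... | refl , h′ rewrite +-suc a k =
      a , ≤-refl , s≤s (m≤m+n a k) , factor-self a , at-a , trans (factor-+ (suc a) k) h′
    segment-++-∷⁻ a (suc k) (_ ∷ u) x v h | just y with ∷-injective h
    ... | refl , h′ = SplitAround-cons at-a (segment-++-∷⁻ (suc a) k u x v h′)

    factor-++⁻ : ∀ {a c} u v → a ≤ c → factor w a c ≡ u ++ v → Split a c u v
    factor-++⁻ {a} {c} u v a≤c h with m≤n⇒∃[o]m+o≡n {a} {c} a≤c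
    ... | k , refl = segment-++⁻ a k u v (trans (sym (factor-+ a k)) h)

    factor-++-∷⁻ : ∀ {a c} u x v → a ≤ c → factor w a c ≡ u ++ x ∷ v → SplitAround a c u x v
    factor-++-∷⁻ {a} {c} u x v a≤c h with m≤n⇒∃[o]m+o≡n {a} {c} a≤c
    ... | k , refl = segment-++-∷⁻ a k u x v (trans (sym (factor-+ a k)) h)

    factor-letter : ∀ {p e q x} → p ≤ e → e < q → factor w p e ≡ [] → letterAt w e ≡ just x →
                    factor w (suc e) q ≡ [] → factor w p q ≡ [ x ]
    factor-letter p≤e e<q before at-e after =
      trans (factor-around p≤e e<q) (cong₂ _++_ before (cong₂ _++_ (cong fromMaybe at-e) after))

  segment-cong : ∀ {n} (w w′ : Word s n) a k → (∀ j → j ∈[ a , a + k ⟩ → letterAt w j ≡ letterAt w′ j) →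
                 segment w a k ≡ segment w′ a k
  segment-cong w w′ a zero    agree = refl
  segment-cong w w′ a (suc k) agree =
    cong₂ (λ m u → fromMaybe m ++ u) (agree a (≤-refl , m<m+n a z<s))
      (segment-cong w w′ (suc a) k λ j (a<j , j<) → agree j (<⇒≤ a<j , subst (j <_) (sym (+-suc a k)) j<))

  factor-setAt-outside : ∀ {n} (w : Word s n) i x {a b} → ¬ toℕ i ∈[ a , b ⟩ → factor (setAt w i x) a b ≡ factor w a b
  factor-setAt-outside w i x {a} {b} i∉ with a ≤? b
  ... | no a≰b rewrite m≤n⇒m∸n≡0 (<⇒≤ (≰⇒> a≰b)) = refl
  ... | yes a≤b with m≤n⇒∃[o]m+o≡n {a} {b} a≤b
  ...   | k , refl = begin
    factor (setAt w i x) a (a + k)  ≡⟨ factor-+ (setAt w i x) a k ⟩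
    segment (setAt w i x) a k       ≡⟨ segment-cong (setAt w i x) w a k agree ⟩
    segment w a k                   ≡⟨ factor-+ w a k ⟨
    factor w a (a + k)              ∎
    where
    open ≡-Reasoning
    agree : ∀ j → j ∈[ a , a + k ⟩ → letterAt (setAt w i x) j ≡ letterAt w j
    agree j j∈ = letterAt-setAt-≢ w i x j λ { refl → i∉ j∈ }

  factor-setAt-inside : ∀ {n} (w : Word s n) i x {a b} → toℕ i ∈[ a , b ⟩ →
                        factor (setAt w i x) a b ≡ factor w a (toℕ i) ++ fromMaybe x ++ factor w (suc (toℕ i)) b
  factor-setAt-inside w i x {a} {b} (a≤i , i<b) = trans (factor-around (setAt w i x) a≤i i<b)
    (cong₂ _++_ (factor-setAt-outside w i x {a} (≥⇒∉ ≤-refl))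
      (cong₂ _++_ (cong fromMaybe (letterAt-setAt-≡ w i x))
        (factor-setAt-outside w i x {b = b} (<⇒∉ ≤-refl))))

  segment-empty : ∀ {n} a k → segment {n} (λ _ → nothing) a k ≡ []
  segment-empty a zero    = refl
  segment-empty {n} a (suc k) rewrite letterAt-empty {n} a = segment-empty {n} (suc a) k

  factor-empty : ∀ {n} a b → factor {n} (λ _ → nothing) a b ≡ []
  factor-empty {n} a b = segment-empty {n} a (b ∸ a)

-- Substitution and derived formulas

weaken : ∀ {v} → Term v → Term (suc v)
weaken (var x) = var (suc x)
weaken dollar  = dollar

evalT-weaken : ∀ {n v} d (ρ : Fin v → Fin (suc n)) t → evalT (extend d ρ) (weaken t) ≡ evalT ρ t
evalT-weaken d ρ (var x) = refl
evalT-weaken d ρ dollar  = refl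

pos : ∀ {n v} → (Fin v → Fin (suc n)) → Term v → ℕ
pos ρ t = toℕ (evalT ρ t)

pos-weaken : ∀ {n v} d (ρ : Fin v → Fin (suc n)) t → pos (extend d ρ) (weaken t) ≡ pos ρ t
pos-weaken d ρ t = cong toℕ (evalT-weaken d ρ t)

substTerm : ∀ {v u} → (Fin v → Term u) → Term v → Term u
substTerm σ (var x) = σ x
substTerm σ dollar  = dollar

liftSubst : ∀ {v u} → (Fin v → Term u) → Fin (suc v) → Term (suc u)
liftSubst σ zero    = var zero
liftSubst σ (suc x) = weaken (σ x)

module _ {s m : ℕ} {ar : Fin m → ℕ} where

  substitute : ∀ {v u} → (Fin v → Term u) → FO s ar v → FO s ar u
  substitute σ (eq t u)     = eq (substTerm σ t) (substTerm σ u)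
  substitute σ (lt t u)     = lt (substTerm σ t) (substTerm σ u)
  substitute σ (letter ζ t) = letter ζ (substTerm σ t)
  substitute σ (aux r ts)   = aux r (map (substTerm σ) ts)
  substitute σ (neg φ)      = neg (substitute σ φ)
  substitute σ (and φ ψ)    = and (substitute σ φ) (substitute σ ψ)
  substitute σ (ex φ)       = ex (substitute (liftSubst σ) φ)

  substitute-CQ : ∀ {v u} (σ : Fin v → Term u) {φ : FO s ar v} → IsCQ φ → IsCQ (substitute σ φ)
  substitute-CQ σ (eq t u)     = eq _ _
  substitute-CQ σ (lt t u)     = lt _ _
  substitute-CQ σ (letter ζ t) = letter ζ _
  substitute-CQ σ (aux r ts)   = aux r _
  substitute-CQ σ (and p q)    = and (substitute-CQ σ p) (substitute-CQ σ q)
  substitute-CQ σ (ex p)       = ex (substitute-CQ (liftSubst σ) p)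

Realises : ∀ {n v u} → (Fin v → Term u) → (Fin u → Fin (suc n)) → (Fin v → Fin (suc n)) → Set
Realises σ ρ ρ′ = ∀ x → evalT ρ (σ x) ≡ ρ′ x

module _ {n v u : ℕ} {σ : Fin v → Term u} {ρ : Fin u → Fin (suc n)} {ρ′ : Fin v → Fin (suc n)} (r : Realises σ ρ ρ′) where

  evalT-substTerm : ∀ t → evalT ρ (substTerm σ t) ≡ evalT ρ′ t
  evalT-substTerm (var x) = r x
  evalT-substTerm dollar  = refl

  map-evalT-substTerm : ∀ {k} (ts : Vec (Term v) k) → map (evalT ρ) (map (substTerm σ) ts) ≡ map (evalT ρ′) ts
  map-evalT-substTerm []       = refl
  map-evalT-substTerm (t ∷ ts) = cong₂ _∷_ (evalT-substTerm t) (map-evalT-substTerm ts)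

  Realises-lift : ∀ d → Realises (liftSubst σ) (extend d ρ) (extend d ρ′)
  Realises-lift d zero    = refl
  Realises-lift d (suc x) = trans (evalT-weaken d ρ (σ x)) (r x)

module _ {s m : ℕ} {ar : Fin m → ℕ} {n : ℕ} (w : Word s n) (A : AuxVal ar n) where

  ⟦substitute⟧ : ∀ {v u} (φ : FO s ar v) {σ : Fin v → Term u} {ρ ρ′} → Realises σ ρ ρ′ →
                 ⟦ substitute σ φ ⟧ w A ρ ⇔ ⟦ φ ⟧ w A ρ′
  ⟦substitute⟧ (eq t t′)    r = ≡⇒⇔ (cong₂ _≡_ (evalT-substTerm r t) (evalT-substTerm r t′))
  ⟦substitute⟧ (lt t t′)    r = ≡⇒⇔ (cong₂ _<ᶠ_ (evalT-substTerm r t) (evalT-substTerm r t′))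
  ⟦substitute⟧ (letter ζ t) r = ≡⇒⇔ (cong (λ d → wAt w d ≡ just ζ) (evalT-substTerm r t))
  ⟦substitute⟧ (aux k ts)   r = ≡⇒⇔ (cong (A k) (map-evalT-substTerm r ts))
  ⟦substitute⟧ (neg φ)      r = ¬-cong-⇔ (⟦substitute⟧ φ r)
  ⟦substitute⟧ (and φ ψ)    r = ⟦substitute⟧ φ r ×-⇔ ⟦substitute⟧ ψ r
  ⟦substitute⟧ (ex φ) {σ} {ρ} {ρ′} r = mk⇔ (λ (d , h) → d , to (body d) h) (λ (d , h) → d , from (body d) h)
    where
    body : ∀ d → ⟦ substitute (liftSubst σ) φ ⟧ w A (extend d ρ) ⇔ ⟦ φ ⟧ w A (extend d ρ′)
    body d = ⟦substitute⟧ φ (Realises-lift r d)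

module _ {s : ℕ} where

  ⟦_⟧? : ∀ {v n} (φ : FO s noAux v) (w : Word s n) ρ → Dec (⟦ φ ⟧ w (noAuxVal n) ρ)
  ⟦ eq t u ⟧?     w ρ = evalT ρ t ≟ᶠ evalT ρ u
  ⟦ lt t u ⟧?     w ρ = evalT ρ t <ᶠ? evalT ρ u
  ⟦ letter ζ t ⟧? w ρ = Maybe.≡-dec _≟ᶠ_ (wAt w (evalT ρ t)) (just ζ)
  ⟦ aux () ts ⟧?  w ρ
  ⟦ neg φ ⟧?      w ρ = ¬? (⟦ φ ⟧? w ρ)
  ⟦ and φ ψ ⟧?    w ρ = ⟦ φ ⟧? w ρ ×-dec ⟦ ψ ⟧? w ρ
  ⟦ ex φ ⟧?       w ρ = any? (λ d → ⟦ φ ⟧? w (extend d ρ))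

module _ {s m : ℕ} {ar : Fin m → ℕ} {v : ℕ} where

  le : Term v → Term v → FO s ar v
  le t u = neg (lt u t)

  or : FO s ar v → FO s ar v → FO s ar v
  or φ ψ = neg (and (neg φ) (neg ψ))

  succ : Term v → Term v → FO s ar v
  succ t u = and (lt t u) (neg (ex (and (lt (weaken t) (var zero)) (lt (var zero) (weaken u)))))

  min : Term v → FO s ar v
  min t = neg (ex (lt (var zero) (weaken t)))

  within : Term v → Term v → Term v → FO s ar v
  within t a b = and (le a t) (lt t b)

  ordered : Term v → Term v → Term v → Term v → FO s ar v
  ordered a b c d = and (le a b) (and (le b c) (le c d))

  module _ {n : ℕ} (w : Word s n) (A : AuxVal ar n) (ρ : Fin v → Fin (suc n)) where

    ⟦eq⟧ : ∀ t u → ⟦ eq t u ⟧ w A ρ ⇔ (pos ρ t ≡ pos ρ u)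
    ⟦eq⟧ t u = mk⇔ (cong toℕ) toℕ-injective

    ⟦le⟧ : ∀ t u → ⟦ le t u ⟧ w A ρ ⇔ (pos ρ t ≤ pos ρ u)
    ⟦le⟧ t u = mk⇔ ≮⇒≥ ≤⇒≯

    ⟦within⟧ : ∀ t a b → ⟦ within t a b ⟧ w A ρ ⇔ pos ρ t ∈[ pos ρ a , pos ρ b ⟩
    ⟦within⟧ t a b = ⟦le⟧ a t ×-⇔ ⇔.refl

    ⟦ordered⟧ : ∀ a b c d → ⟦ ordered a b c d ⟧ w A ρ ⇔ Chain (pos ρ a) (pos ρ b) (pos ρ c) (pos ρ d)
    ⟦ordered⟧ a b c d = ⟦le⟧ a b ×-⇔ ⟦le⟧ b c ×-⇔ ⟦le⟧ c d

    ⟦succ⟧ : ∀ t u → ⟦ succ t u ⟧ w A ρ ⇔ (pos ρ u ≡ suc (pos ρ t))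
    ⟦succ⟧ t u = mk⇔ sound complete
      where
      sound : ⟦ succ t u ⟧ w A ρ → pos ρ u ≡ suc (pos ρ t)
      sound (t<u , no-between) with m≤n⇒m<n∨m≡n t<u
      ... | inj₂ t+1≡u = sym t+1≡u
      ... | inj₁ t+1<u = ⊥-elim (no-between (d , t<d , d<u))
        where
        t+1<n+1 : suc (pos ρ t) < suc n
        t+1<n+1 = <-trans t+1<u (toℕ<n (evalT ρ u))
        d : Fin (suc n)
        d = fromℕ< t+1<n+1
        t<d : toℕ (evalT (extend d ρ) (weaken t)) < toℕ d
        t<d rewrite pos-weaken d ρ t | toℕ-fromℕ< t+1<n+1 = ≤-refl
        d<u : toℕ d < toℕ (evalT (extend d ρ) (weaken u))
        d<u rewrite pos-weaken d ρ u | toℕ-fromℕ< t+1<n+1 = t+1<u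
      complete : pos ρ u ≡ suc (pos ρ t) → ⟦ succ t u ⟧ w A ρ
      complete u≡t+1 = subst (pos ρ t <_) (sym u≡t+1) ≤-refl , λ (d , t<d , d<u) →
        <-irrefl refl (<-≤-trans (subst (toℕ d <_) (trans (pos-weaken d ρ u) u≡t+1) d<u)
                                 (subst (_< toℕ d) (pos-weaken d ρ t) t<d))

    ⟦min⟧ : ∀ t → ⟦ min t ⟧ w A ρ ⇔ (pos ρ t ≡ 0)
    ⟦min⟧ t = mk⇔ sound complete
      where
      sound : ⟦ min t ⟧ w A ρ → pos ρ t ≡ 0
      sound nothing-below with pos ρ t in t≡
      ... | zero  = refl
      ... | suc _ = ⊥-elim (nothing-below (zero , subst (0 <_) (sym (trans (pos-weaken zero ρ t) t≡)) z<s))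
      complete : pos ρ t ≡ 0 → ⟦ min t ⟧ w A ρ
      complete t≡0 (d , d<t) with subst (toℕ d <_) (trans (pos-weaken d ρ t) t≡0) d<t
      ... | ()

module _ {s v n : ℕ} (w : Word s n) (ρ : Fin v → Fin (suc n)) where

  ⟦or⟧ : ∀ {φ ψ : FO s noAux v} {P Q : Set} → ⟦ φ ⟧ w (noAuxVal n) ρ ⇔ P → ⟦ ψ ⟧ w (noAuxVal n) ρ ⇔ Q →
         ⟦ or φ ψ ⟧ w (noAuxVal n) ρ ⇔ (P ⊎ Q)
  ⟦or⟧ {φ} {ψ} {P} {Q} φ⇔P ψ⇔Q = mk⇔ sound complete
    where
    sound : ⟦ or φ ψ ⟧ w (noAuxVal n) ρ → P ⊎ Q
    sound ¬¬φ∨ψ with ⟦ φ ⟧? w ρ | ⟦ ψ ⟧? w ρ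
    ... | yes φ-holds | _            = inj₁ (to φ⇔P φ-holds)
    ... | no _        | yes ψ-holds  = inj₂ (to ψ⇔Q ψ-holds)
    ... | no ¬φ       | no ¬ψ        = ⊥-elim (¬¬φ∨ψ (¬φ , ¬ψ))
    complete : P ⊎ Q → ⟦ or φ ψ ⟧ w (noAuxVal n) ρ
    complete (inj₁ p) (¬φ , _) = ¬φ (from φ⇔P p)
    complete (inj₂ q) (_ , ¬ψ) = ¬ψ (from ψ⇔Q q)

-- Factor equality under a point update

-- The three ways EQ(a, b, c, d) can hold after ζ is inserted at y: y lies in neither factor and
-- EQ(q) = EQ(r) = EQ(a, b, c, d) held before; or y lies in one factor and corresponds to the position
-- e of the other, which carries ζ, while EQ(q) and EQ(r) equate the parts before and after y and e.
InsCases : (y a b c d e q₁ q₂ q₃ q₄ r₁ r₂ r₃ r₄ : ℕ) → Set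
InsCases y a b c d e q₁ q₂ q₃ q₄ r₁ r₂ r₃ r₄ =
    (¬ y ∈[ a , b ⟩ × ¬ y ∈[ c , d ⟩ × e ≡ y
       × q₁ ≡ a × q₂ ≡ b × q₃ ≡ c × q₄ ≡ d × r₁ ≡ a × r₂ ≡ b × r₃ ≡ c × r₄ ≡ d)
  ⊎ (y ∈[ a , b ⟩ × e ∈[ c , d ⟩
       × q₁ ≡ a × q₂ ≡ y × q₃ ≡ c × q₄ ≡ e × r₁ ≡ suc y × r₂ ≡ b × r₃ ≡ suc e × r₄ ≡ d)
  ⊎ (y ∈[ c , d ⟩ × e ∈[ a , b ⟩
       × q₁ ≡ a × q₂ ≡ e × q₃ ≡ c × q₄ ≡ y × r₁ ≡ suc e × r₂ ≡ b × r₃ ≡ suc y × r₄ ≡ d)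

-- The same for a reset at y; now the position e of the other factor is where its split happens.
ResetCases : (y a b c d e q₁ q₂ q₃ q₄ r₁ r₂ r₃ r₄ : ℕ) → Set
ResetCases y a b c d e q₁ q₂ q₃ q₄ r₁ r₂ r₃ r₄ =
    (¬ y ∈[ a , b ⟩ × ¬ y ∈[ c , d ⟩
       × q₁ ≡ a × q₂ ≡ b × q₃ ≡ c × q₄ ≡ d × r₁ ≡ a × r₂ ≡ b × r₃ ≡ c × r₄ ≡ d)
  ⊎ (y ∈[ a , b ⟩ × c ≤ e × e ≤ d
       × q₁ ≡ a × q₂ ≡ y × q₃ ≡ c × q₄ ≡ e × r₁ ≡ suc y × r₂ ≡ b × r₃ ≡ e × r₄ ≡ d)
  ⊎ (y ∈[ c , d ⟩ × a ≤ e × e ≤ b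
       × q₁ ≡ a × q₂ ≡ e × q₃ ≡ c × q₄ ≡ y × r₁ ≡ e × r₂ ≡ b × r₃ ≡ suc y × r₄ ≡ d)

record SelIns (y a b c d e q₁ q₂ q₃ q₄ r₁ r₂ r₃ r₄ : ℕ) : Set where
  constructor selIns
  field
    chain : Chain a b c d
    cases : InsCases y a b c d e q₁ q₂ q₃ q₄ r₁ r₂ r₃ r₄

record SelReset (y a b c d e q₁ q₂ q₃ q₄ r₁ r₂ r₃ r₄ : ℕ) : Set where
  constructor selReset
  field
    chain : Chain a b c d
    cases : ResetCases y a b c d e q₁ q₂ q₃ q₄ r₁ r₂ r₃ r₄

module _ {s : ℕ} where

  FactorEq : ∀ {n} → Word s n → ℕ → ℕ → ℕ → ℕ → Set
  FactorEq w a b c d = Chain a b c d × factor w a b ≡ factor w c d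

  module _ {n} (w : Word s n) (i : Fin n) where

    private
      y = toℕ i

    FactorEq-setAt-outside : ∀ x {a b c d} → ¬ y ∈[ a , b ⟩ → ¬ y ∈[ c , d ⟩ →
                             FactorEq (setAt w i x) a b c d ⇔ FactorEq w a b c d
    FactorEq-setAt-outside x y∉ab y∉cd = mk⇔
      (λ (chain , h) → chain , trans (sym (factor-setAt-outside w i x y∉ab)) (trans h (factor-setAt-outside w i x y∉cd)))
      (λ (chain , h) → chain , trans (factor-setAt-outside w i x y∉ab) (trans h (sym (factor-setAt-outside w i x y∉cd))))

    module _ (ζ : Fin s) where

      private
        w′ = setAt w i (just ζ)

        letterAt-≢ : ∀ {j} → j ≢ y → letterAt w′ j ≡ letterAt w j
        letterAt-≢ {j} = letterAt-setAt-≢ w i (just ζ) j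

        outside : ∀ {a b} → ¬ y ∈[ a , b ⟩ → factor w′ a b ≡ factor w a b
        outside = factor-setAt-outside w i (just ζ)

      FactorEq-ins-sound : ∀ {a b c d e q₁ q₂ q₃ q₄ r₁ r₂ r₃ r₄} → SelIns y a b c d e q₁ q₂ q₃ q₄ r₁ r₂ r₃ r₄ →
                           letterAt w′ e ≡ just ζ → FactorEq w q₁ q₂ q₃ q₄ → FactorEq w r₁ r₂ r₃ r₄ →
                           FactorEq w′ a b c d
      FactorEq-ins-sound (selIns chain (inj₁ (y∉ab , y∉cd , refl , refl , refl , refl , refl , refl , refl , refl , refl))) _ q _ =
        from (FactorEq-setAt-outside (just ζ) y∉ab y∉cd) q
      FactorEq-ins-sound {a} {b} {c} {d} {e} (selIns chain@(_ , b≤c , _)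
        (inj₂ (inj₁ (y∈ab@(_ , y<b) , (c≤e , e<d) , refl , refl , refl , refl , refl , refl , refl , refl))))
        ζ-at-e (_ , before) (_ , after) = chain , (begin
          factor w′ a b                                         ≡⟨ factor-setAt-inside w i (just ζ) y∈ab ⟩
          factor w a y ++ [ ζ ] ++ factor w (suc y) b           ≡⟨ cong₂ (λ u v → u ++ [ ζ ] ++ v) before after ⟩
          factor w c e ++ [ ζ ] ++ factor w (suc e) d           ≡⟨ cong₂ (λ u v → u ++ [ ζ ] ++ v) (outside {c} {e} (<⇒∉ y<c))
                                                                         (outside {suc e} {d} (<⇒∉ (<-trans y<c (s≤s c≤e)))) ⟨
          factor w′ c e ++ [ ζ ] ++ factor w′ (suc e) d         ≡⟨ cong (λ m → factor w′ c e ++ fromMaybe m ++ factor w′ (suc e) d) ζ-at-e ⟨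
          factor w′ c e ++ fromMaybe (letterAt w′ e) ++ factor w′ (suc e) d ≡⟨ factor-around w′ c≤e e<d ⟨
          factor w′ c d                                         ∎)
        where
        open ≡-Reasoning
        y<c : y < c
        y<c = <-≤-trans y<b b≤c
      FactorEq-ins-sound {a} {b} {c} {d} {e} (selIns chain@(_ , b≤c , _)
        (inj₂ (inj₂ (y∈cd@(c≤y , _) , (a≤e , e<b) , refl , refl , refl , refl , refl , refl , refl , refl))))
        ζ-at-e (_ , before) (_ , after) = chain , (begin
          factor w′ a b                                         ≡⟨ factor-around w′ a≤e e<b ⟩
          factor w′ a e ++ fromMaybe (letterAt w′ e) ++ factor w′ (suc e) b ≡⟨ cong (λ m → factor w′ a e ++ fromMaybe m ++ factor w′ (suc e) b) ζ-at-e ⟩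
          factor w′ a e ++ [ ζ ] ++ factor w′ (suc e) b         ≡⟨ cong₂ (λ u v → u ++ [ ζ ] ++ v) (outside {a} {e} (≥⇒∉ (≤-trans (<⇒≤ e<b) b≤y)))
                                                                         (outside {suc e} {b} (≥⇒∉ b≤y)) ⟩
          factor w a e ++ [ ζ ] ++ factor w (suc e) b           ≡⟨ cong₂ (λ u v → u ++ [ ζ ] ++ v) before after ⟩
          factor w c y ++ [ ζ ] ++ factor w (suc y) d           ≡⟨ factor-setAt-inside w i (just ζ) y∈cd ⟨
          factor w′ c d                                         ∎)
        where
        open ≡-Reasoning
        b≤y : b ≤ y
        b≤y = ≤-trans b≤c c≤y

      FactorEq-ins-first : ∀ {a b c d} → y ∈[ a , b ⟩ → FactorEq w′ a b c d →
                           ∃[ e ] e ∈[ c , d ⟩ × letterAt w′ e ≡ just ζ × FactorEq w a y c e × FactorEq w (suc y) b (suc e) d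
      FactorEq-ins-first {a} {b} {c} {d} y∈ab@(a≤y , y<b) ((_ , b≤c , c≤d) , h) =
        extract (factor-++-∷⁻ w (factor w a y) ζ (factor w (suc y) b) c≤d
                  (trans (sym (outside {c} {d} (<⇒∉ y<c))) (trans (sym h) (factor-setAt-inside w i (just ζ) y∈ab))))
        where
        y<c : y < c
        y<c = <-≤-trans y<b b≤c
        extract : SplitAround w c d (factor w a y) ζ (factor w (suc y) b) →
                  ∃[ e ] e ∈[ c , d ⟩ × letterAt w′ e ≡ just ζ × FactorEq w a y c e × FactorEq w (suc y) b (suc e) d
        extract (e , c≤e , e<d , before , ζ-at-e , after) =
          e , (c≤e , e<d) , trans (letterAt-≢ (>⇒≢ (<-≤-trans y<c c≤e))) ζ-at-e ,
          ((a≤y , <⇒≤ y<c , c≤e) , sym before) , ((y<b , ≤-trans b≤c (≤-trans c≤e (n≤1+n e)) , e<d) , sym after)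

      FactorEq-ins-second : ∀ {a b c d} → y ∈[ c , d ⟩ → FactorEq w′ a b c d →
                            ∃[ e ] e ∈[ a , b ⟩ × letterAt w′ e ≡ just ζ × FactorEq w a e c y × FactorEq w (suc e) b (suc y) d
      FactorEq-ins-second {a} {b} {c} {d} y∈cd@(c≤y , y<d) ((a≤b , b≤c , _) , h) =
        extract (factor-++-∷⁻ w (factor w c y) ζ (factor w (suc y) d) a≤b
                  (trans (sym (outside {a} {b} (≥⇒∉ b≤y))) (trans h (factor-setAt-inside w i (just ζ) y∈cd))))
        where
        b≤y : b ≤ y
        b≤y = ≤-trans b≤c c≤y
        extract : SplitAround w a b (factor w c y) ζ (factor w (suc y) d) →
                  ∃[ e ] e ∈[ a , b ⟩ × letterAt w′ e ≡ just ζ × FactorEq w a e c y × FactorEq w (suc e) b (suc y) d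
        extract (e , a≤e , e<b , before , ζ-at-e , after) =
          e , (a≤e , e<b) , trans (letterAt-≢ (<⇒≢ (<-≤-trans e<b b≤y))) ζ-at-e ,
          ((a≤e , ≤-trans (<⇒≤ e<b) b≤c , c≤y) , before) , ((e<b , ≤-trans b≤y (n≤1+n y) , y<d) , after)

    private
      w₀ = setAt w i nothing

      outside₀ : ∀ {a b} → ¬ y ∈[ a , b ⟩ → factor w₀ a b ≡ factor w a b
      outside₀ = factor-setAt-outside w i nothing

    FactorEq-reset-sound : ∀ {a b c d e q₁ q₂ q₃ q₄ r₁ r₂ r₃ r₄} → SelReset y a b c d e q₁ q₂ q₃ q₄ r₁ r₂ r₃ r₄ →
                           FactorEq w q₁ q₂ q₃ q₄ → FactorEq w r₁ r₂ r₃ r₄ → FactorEq w₀ a b c d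
    FactorEq-reset-sound (selReset chain (inj₁ (y∉ab , y∉cd , refl , refl , refl , refl , refl , refl , refl , refl))) q _ =
      from (FactorEq-setAt-outside nothing y∉ab y∉cd) q
    FactorEq-reset-sound {a} {b} {c} {d} {e} (selReset chain@(_ , b≤c , _)
      (inj₂ (inj₁ (y∈ab@(_ , y<b) , c≤e , e≤d , refl , refl , refl , refl , refl , refl , refl , refl))))
      (_ , before) (_ , after) = chain , (begin
        factor w₀ a b                       ≡⟨ factor-setAt-inside w i nothing y∈ab ⟩
        factor w a y ++ factor w (suc y) b  ≡⟨ cong₂ _++_ before after ⟩
        factor w c e ++ factor w e d        ≡⟨ factor-split w c≤e e≤d ⟨
        factor w c d                        ≡⟨ outside₀ {c} {d} (<⇒∉ (<-≤-trans y<b b≤c)) ⟨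
        factor w₀ c d                       ∎)
      where open ≡-Reasoning
    FactorEq-reset-sound {a} {b} {c} {d} {e} (selReset chain@(_ , b≤c , _)
      (inj₂ (inj₂ (y∈cd@(c≤y , _) , a≤e , e≤b , refl , refl , refl , refl , refl , refl , refl , refl))))
      (_ , before) (_ , after) = chain , (begin
        factor w₀ a b                       ≡⟨ outside₀ {a} {b} (≥⇒∉ (≤-trans b≤c c≤y)) ⟩
        factor w a b                        ≡⟨ factor-split w a≤e e≤b ⟩
        factor w a e ++ factor w e b        ≡⟨ cong₂ _++_ before after ⟩
        factor w c y ++ factor w (suc y) d  ≡⟨ factor-setAt-inside w i nothing y∈cd ⟨
        factor w₀ c d                       ∎)
      where open ≡-Reasoning

    FactorEq-reset-first : ∀ {a b c d} → y ∈[ a , b ⟩ → FactorEq w₀ a b c d →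
                           ∃[ e ] c ≤ e × e ≤ d × FactorEq w a y c e × FactorEq w (suc y) b e d
    FactorEq-reset-first {a} {b} {c} {d} y∈ab@(a≤y , y<b) ((_ , b≤c , c≤d) , h) =
      extract (factor-++⁻ w (factor w a y) (factor w (suc y) b) c≤d
                (trans (sym (outside₀ {c} {d} (<⇒∉ y<c))) (trans (sym h) (factor-setAt-inside w i nothing y∈ab))))
      where
      y<c : y < c
      y<c = <-≤-trans y<b b≤c
      extract : Split w c d (factor w a y) (factor w (suc y) b) →
                ∃[ e ] c ≤ e × e ≤ d × FactorEq w a y c e × FactorEq w (suc y) b e d
      extract (e , c≤e , e≤d , before , after) =
        e , c≤e , e≤d , ((a≤y , <⇒≤ y<c , c≤e) , sym before) , ((y<b , ≤-trans b≤c c≤e , e≤d) , sym after)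

    FactorEq-reset-second : ∀ {a b c d} → y ∈[ c , d ⟩ → FactorEq w₀ a b c d →
                            ∃[ e ] a ≤ e × e ≤ b × FactorEq w a e c y × FactorEq w e b (suc y) d
    FactorEq-reset-second {a} {b} {c} {d} y∈cd@(c≤y , y<d) ((a≤b , b≤c , _) , h) =
      extract (factor-++⁻ w (factor w c y) (factor w (suc y) d) a≤b
                (trans (sym (outside₀ {a} {b} (≥⇒∉ b≤y))) (trans h (factor-setAt-inside w i nothing y∈cd))))
      where
      b≤y : b ≤ y
      b≤y = ≤-trans b≤c c≤y
      extract : Split w a b (factor w c y) (factor w (suc y) d) →
                ∃[ e ] a ≤ e × e ≤ b × FactorEq w a e c y × FactorEq w e b (suc y) d
      extract (e , a≤e , e≤b , before , after) =
        e , a≤e , e≤b , ((a≤e , ≤-trans e≤b b≤c , c≤y) , before) , ((e≤b , ≤-trans b≤y (n≤1+n y) , y<d) , after)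

module _ {s : ℕ} where

  private
    y a b c d e q₁ q₂ q₃ q₄ r₁ r₂ r₃ r₄ : Term 14
    y  = var (# 0)
    a  = var (# 1)
    b  = var (# 2)
    c  = var (# 3)
    d  = var (# 4)
    e  = var (# 5)
    q₁ = var (# 6)
    q₂ = var (# 7)
    q₃ = var (# 8)
    q₄ = var (# 9)
    r₁ = var (# 10)
    r₂ = var (# 11)
    r₃ = var (# 12)
    r₄ = var (# 13)

    insOutside insFirst insSecond resetOutside resetFirst resetSecond : FO s noAux 14
    insOutside   = and (neg (within y a b)) (and (neg (within y c d)) (and (eq e y)
                     (and (eq q₁ a) (and (eq q₂ b) (and (eq q₃ c) (and (eq q₄ d)
                     (and (eq r₁ a) (and (eq r₂ b) (and (eq r₃ c) (eq r₄ d))))))))))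
    insFirst     = and (within y a b) (and (within e c d)
                     (and (eq q₁ a) (and (eq q₂ y) (and (eq q₃ c) (and (eq q₄ e)
                     (and (succ y r₁) (and (eq r₂ b) (and (succ e r₃) (eq r₄ d)))))))))
    insSecond    = and (within y c d) (and (within e a b)
                     (and (eq q₁ a) (and (eq q₂ e) (and (eq q₃ c) (and (eq q₄ y)
                     (and (succ e r₁) (and (eq r₂ b) (and (succ y r₃) (eq r₄ d)))))))))
    resetOutside = and (neg (within y a b)) (and (neg (within y c d))
                     (and (eq q₁ a) (and (eq q₂ b) (and (eq q₃ c) (and (eq q₄ d)
                     (and (eq r₁ a) (and (eq r₂ b) (and (eq r₃ c) (eq r₄ d)))))))))
    resetFirst   = and (within y a b) (and (le c e) (and (le e d)
                     (and (eq q₁ a) (and (eq q₂ y) (and (eq q₃ c) (and (eq q₄ e)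
                     (and (succ y r₁) (and (eq r₂ b) (and (eq r₃ e) (eq r₄ d))))))))))
    resetSecond  = and (within y c d) (and (le a e) (and (le e b)
                     (and (eq q₁ a) (and (eq q₂ e) (and (eq q₃ c) (and (eq q₄ y)
                     (and (eq r₁ e) (and (eq r₂ b) (and (succ y r₃) (eq r₄ d))))))))))

  selInsF : FO s noAux 14
  selInsF = and (ordered a b c d) (or insOutside (or insFirst insSecond))

  selResetF : FO s noAux 14
  selResetF = and (ordered a b c d) (or resetOutside (or resetFirst resetSecond))

  module _ {n : ℕ} (w : Word s n) (ρ : Fin 14 → Fin (suc n)) where

    private
      A₀ : AuxVal noAux n
      A₀ = noAuxVal n

      ⟪_⟫ : Term 14 → ℕ
      ⟪ t ⟫ = pos ρ t

      ⟦=⟧ : ∀ t u → ⟦ eq t u ⟧ w A₀ ρ ⇔ (⟪ t ⟫ ≡ ⟪ u ⟫)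
      ⟦=⟧ = ⟦eq⟧ w A₀ ρ

      ⟦≤⟧ : ∀ t u → ⟦ le t u ⟧ w A₀ ρ ⇔ (⟪ t ⟫ ≤ ⟪ u ⟫)
      ⟦≤⟧ = ⟦le⟧ w A₀ ρ

      ⟦+1⟧ : ∀ t u → ⟦ succ t u ⟧ w A₀ ρ ⇔ (⟪ u ⟫ ≡ suc ⟪ t ⟫)
      ⟦+1⟧ = ⟦succ⟧ w A₀ ρ

      ⟦∈⟧ : ∀ t u v → ⟦ within t u v ⟧ w A₀ ρ ⇔ ⟪ t ⟫ ∈[ ⟪ u ⟫ , ⟪ v ⟫ ⟩
      ⟦∈⟧ = ⟦within⟧ w A₀ ρ

    ⟦selIns⟧ : ⟦ selInsF ⟧ w A₀ ρ ⇔
               SelIns ⟪ y ⟫ ⟪ a ⟫ ⟪ b ⟫ ⟪ c ⟫ ⟪ d ⟫ ⟪ e ⟫ ⟪ q₁ ⟫ ⟪ q₂ ⟫ ⟪ q₃ ⟫ ⟪ q₄ ⟫ ⟪ r₁ ⟫ ⟪ r₂ ⟫ ⟪ r₃ ⟫ ⟪ r₄ ⟫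
    ⟦selIns⟧ = ⇔.trans
      (⟦ordered⟧ w A₀ ρ a b c d ×-⇔ ⟦or⟧ w ρ {insOutside} {or insFirst insSecond}
        (¬-cong-⇔ (⟦∈⟧ y a b) ×-⇔ ¬-cong-⇔ (⟦∈⟧ y c d) ×-⇔ ⟦=⟧ e y
          ×-⇔ ⟦=⟧ q₁ a ×-⇔ ⟦=⟧ q₂ b ×-⇔ ⟦=⟧ q₃ c ×-⇔ ⟦=⟧ q₄ d ×-⇔ ⟦=⟧ r₁ a ×-⇔ ⟦=⟧ r₂ b ×-⇔ ⟦=⟧ r₃ c ×-⇔ ⟦=⟧ r₄ d)
        (⟦or⟧ w ρ {insFirst} {insSecond}
          (⟦∈⟧ y a b ×-⇔ ⟦∈⟧ e c d ×-⇔ ⟦=⟧ q₁ a ×-⇔ ⟦=⟧ q₂ y ×-⇔ ⟦=⟧ q₃ c ×-⇔ ⟦=⟧ q₄ e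
            ×-⇔ ⟦+1⟧ y r₁ ×-⇔ ⟦=⟧ r₂ b ×-⇔ ⟦+1⟧ e r₃ ×-⇔ ⟦=⟧ r₄ d)
          (⟦∈⟧ y c d ×-⇔ ⟦∈⟧ e a b ×-⇔ ⟦=⟧ q₁ a ×-⇔ ⟦=⟧ q₂ e ×-⇔ ⟦=⟧ q₃ c ×-⇔ ⟦=⟧ q₄ y
            ×-⇔ ⟦+1⟧ e r₁ ×-⇔ ⟦=⟧ r₂ b ×-⇔ ⟦+1⟧ y r₃ ×-⇔ ⟦=⟧ r₄ d)))
      (mk⇔ (λ (chain , cases) → selIns chain cases) (λ (selIns chain cases) → chain , cases))

    ⟦selReset⟧ : ⟦ selResetF ⟧ w A₀ ρ ⇔
                 SelReset ⟪ y ⟫ ⟪ a ⟫ ⟪ b ⟫ ⟪ c ⟫ ⟪ d ⟫ ⟪ e ⟫ ⟪ q₁ ⟫ ⟪ q₂ ⟫ ⟪ q₃ ⟫ ⟪ q₄ ⟫ ⟪ r₁ ⟫ ⟪ r₂ ⟫ ⟪ r₃ ⟫ ⟪ r₄ ⟫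
    ⟦selReset⟧ = ⇔.trans
      (⟦ordered⟧ w A₀ ρ a b c d ×-⇔ ⟦or⟧ w ρ {resetOutside} {or resetFirst resetSecond}
        (¬-cong-⇔ (⟦∈⟧ y a b) ×-⇔ ¬-cong-⇔ (⟦∈⟧ y c d)
          ×-⇔ ⟦=⟧ q₁ a ×-⇔ ⟦=⟧ q₂ b ×-⇔ ⟦=⟧ q₃ c ×-⇔ ⟦=⟧ q₄ d ×-⇔ ⟦=⟧ r₁ a ×-⇔ ⟦=⟧ r₂ b ×-⇔ ⟦=⟧ r₃ c ×-⇔ ⟦=⟧ r₄ d)
        (⟦or⟧ w ρ {resetFirst} {resetSecond}
          (⟦∈⟧ y a b ×-⇔ ⟦≤⟧ c e ×-⇔ ⟦≤⟧ e d ×-⇔ ⟦=⟧ q₁ a ×-⇔ ⟦=⟧ q₂ y ×-⇔ ⟦=⟧ q₃ c ×-⇔ ⟦=⟧ q₄ e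
            ×-⇔ ⟦+1⟧ y r₁ ×-⇔ ⟦=⟧ r₂ b ×-⇔ ⟦=⟧ r₃ e ×-⇔ ⟦=⟧ r₄ d)
          (⟦∈⟧ y c d ×-⇔ ⟦≤⟧ a e ×-⇔ ⟦≤⟧ e b ×-⇔ ⟦=⟧ q₁ a ×-⇔ ⟦=⟧ q₂ e ×-⇔ ⟦=⟧ q₃ c ×-⇔ ⟦=⟧ q₄ y
            ×-⇔ ⟦=⟧ r₁ e ×-⇔ ⟦=⟧ r₂ b ×-⇔ ⟦+1⟧ y r₃ ×-⇔ ⟦=⟧ r₄ d)))
      (mk⇔ (λ (chain , cases) → selReset chain cases) (λ (selReset chain cases) → chain , cases))

-- The auxiliary relations and the update formula of EQ

pattern ACC       = zero
pattern EQ        = suc zero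
pattern SEL-INS   = suc (suc zero)
pattern SEL-RESET = suc (suc (suc zero))
pattern SUCC      = suc (suc (suc (suc zero)))
pattern MIN       = suc (suc (suc (suc (suc zero))))
pattern LE        = suc (suc (suc (suc (suc (suc zero)))))

auxArity : Fin 7 → ℕ
auxArity ACC       = 0
auxArity EQ        = 4
auxArity SEL-INS   = 14
auxArity SEL-RESET = 14
auxArity SUCC      = 2
auxArity MIN       = 1
auxArity LE        = 2

module _ {s : ℕ} where

  -- The free variables of the update formula of EQ are y, a, b, c, d (from index 0); nine
  -- quantifiers then bind e, q₁, …, q₄, r₁, …, r₄.
  private
    y a b c d e q₁ q₂ q₃ q₄ r₁ r₂ r₃ r₄ : Term 14
    r₄ = var (# 0)
    r₃ = var (# 1)
    r₂ = var (# 2)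
    r₁ = var (# 3)
    q₄ = var (# 4)
    q₃ = var (# 5)
    q₂ = var (# 6)
    q₁ = var (# 7)
    e  = var (# 8)
    y  = var (# 9)
    a  = var (# 10)
    b  = var (# 11)
    c  = var (# 12)
    d  = var (# 13)

    ∃⁹ : FO s auxArity 14 → FO s auxArity 5
    ∃⁹ φ = ex (ex (ex (ex (ex (ex (ex (ex (ex φ))))))))

    selArgs : Vec (Term 14) 14
    selArgs = y ∷ a ∷ b ∷ c ∷ d ∷ e ∷ q₁ ∷ q₂ ∷ q₃ ∷ q₄ ∷ r₁ ∷ r₂ ∷ r₃ ∷ r₄ ∷ []

    eqQ eqR : FO s auxArity 14
    eqQ = aux EQ (q₁ ∷ q₂ ∷ q₃ ∷ q₄ ∷ [])
    eqR = aux EQ (r₁ ∷ r₂ ∷ r₃ ∷ r₄ ∷ [])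

  eqUpd : Op s → FO s auxArity 5
  eqUpd (insOp ζ) = ∃⁹ (and (aux SEL-INS selArgs) (and (letter ζ e) (and eqQ eqR)))
  eqUpd resetOp   = ∃⁹ (and (aux SEL-RESET selArgs) (and eqQ eqR))

  eqUpd-CQ : ∀ op → IsCQ (eqUpd op)
  eqUpd-CQ (insOp ζ) = ex (ex (ex (ex (ex (ex (ex (ex (ex (and (aux _ _) (and (letter _ _) (and (aux _ _) (aux _ _))))))))))))
  eqUpd-CQ resetOp   = ex (ex (ex (ex (ex (ex (ex (ex (ex (and (aux _ _) (and (aux _ _) (aux _ _)))))))))))

module _ {s : ℕ} where

  record Invariant {n} (w : Word s n) (A : AuxVal auxArity n) : Set where
    field
      eqRel       : ∀ {a b c d} → A EQ (a ∷ b ∷ c ∷ d ∷ []) ⇔ FactorEq w (toℕ a) (toℕ b) (toℕ c) (toℕ d)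
      selInsRel   : ∀ {y a b c d e q₁ q₂ q₃ q₄ r₁ r₂ r₃ r₄} →
                    A SEL-INS (y ∷ a ∷ b ∷ c ∷ d ∷ e ∷ q₁ ∷ q₂ ∷ q₃ ∷ q₄ ∷ r₁ ∷ r₂ ∷ r₃ ∷ r₄ ∷ []) ⇔
                    SelIns (toℕ y) (toℕ a) (toℕ b) (toℕ c) (toℕ d) (toℕ e)
                           (toℕ q₁) (toℕ q₂) (toℕ q₃) (toℕ q₄) (toℕ r₁) (toℕ r₂) (toℕ r₃) (toℕ r₄)
      selResetRel : ∀ {y a b c d e q₁ q₂ q₃ q₄ r₁ r₂ r₃ r₄} →
                    A SEL-RESET (y ∷ a ∷ b ∷ c ∷ d ∷ e ∷ q₁ ∷ q₂ ∷ q₃ ∷ q₄ ∷ r₁ ∷ r₂ ∷ r₃ ∷ r₄ ∷ []) ⇔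
                    SelReset (toℕ y) (toℕ a) (toℕ b) (toℕ c) (toℕ d) (toℕ e)
                             (toℕ q₁) (toℕ q₂) (toℕ q₃) (toℕ q₄) (toℕ r₁) (toℕ r₂) (toℕ r₃) (toℕ r₄)
      succRel     : ∀ {a b} → A SUCC (a ∷ b ∷ []) ⇔ (toℕ b ≡ suc (toℕ a))
      minRel      : ∀ {a} → A MIN (a ∷ []) ⇔ (toℕ a ≡ 0)
      leRel       : ∀ {a b} → A LE (a ∷ b ∷ []) ⇔ (toℕ a ≤ toℕ b)

  FactorEq-cong : ∀ {n} {w : Word s n} {a a′ b b′ c c′ d d′} → a ≡ a′ → b ≡ b′ → c ≡ c′ → d ≡ d′ →
                  FactorEq w a b c d → FactorEq w a′ b′ c′ d′
  FactorEq-cong refl refl refl refl fe = fe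

  module _ {n} {w : Word s n} {A : AuxVal auxArity n} (inv : Invariant w A) (i : Fin n) (ρ : Fin 5 → Fin (suc n))
           (y≡i : toℕ (ρ zero) ≡ toℕ i) where

    open Invariant inv

    private
      Y = toℕ i
      a₀ = ρ (# 1)
      b₀ = ρ (# 2)
      c₀ = ρ (# 3)
      d₀ = ρ (# 4)
      a b c d : ℕ
      a = toℕ a₀
      b = toℕ b₀
      c = toℕ c₀
      d = toℕ d₀

      ≤toℕ⇒<1+n : ∀ {e} (x : Fin (suc n)) → e ≤ toℕ x → e < suc n
      ≤toℕ⇒<1+n x e≤x = <-≤-trans (s≤s e≤x) (toℕ<n x)

      y∈⇒ρ₀∈ : ∀ {a b} → Y ∈[ a , b ⟩ → toℕ (ρ zero) ∈[ a , b ⟩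
      y∈⇒ρ₀∈ = subst (_∈[ _ , _ ⟩) (sym y≡i)

      y∉⇒ρ₀∉ : ∀ {a b} → ¬ Y ∈[ a , b ⟩ → ¬ toℕ (ρ zero) ∈[ a , b ⟩
      y∉⇒ρ₀∉ y∉ = y∉ ∘ subst (_∈[ _ , _ ⟩) y≡i

    module _ (ζ : Fin s) where

      private
        w′ = setAt w i (just ζ)

      ⟦eqUpd-ins⟧ : ⟦ eqUpd (insOp ζ) ⟧ w′ A ρ ⇔ FactorEq w′ a b c d
      ⟦eqUpd-ins⟧ = mk⇔ sound complete
        where
        sound : ⟦ eqUpd (insOp ζ) ⟧ w′ A ρ → FactorEq w′ a b c d
        sound (e , q₁ , q₂ , q₃ , q₄ , r₁ , r₂ , r₃ , r₄ , sel , ζ-at-e , eq-q , eq-r) =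
          FactorEq-ins-sound w i ζ (subst (λ y → SelIns y _ _ _ _ _ _ _ _ _ _ _ _ _) y≡i (to selInsRel sel))
            (trans (sym (wAt≡letterAt w′ e)) ζ-at-e) (to eqRel eq-q) (to eqRel eq-r)
        complete : FactorEq w′ a b c d → ⟦ eqUpd (insOp ζ) ⟧ w′ A ρ
        complete fe@(chain , _) with Y ∈[ a , b ⟩? | Y ∈[ c , d ⟩?
        ... | yes y∈ab | _ with FactorEq-ins-first w i ζ y∈ab fe
        ...   | e , e∈cd@(_ , e<d) , ζ-at-e , fq , fr
                with toℕ-onto (≤toℕ⇒<1+n d₀ (<⇒≤ e<d)) | toℕ-onto (≤toℕ⇒<1+n d₀ e<d)
        ...     | E , refl | E′ , E′≡ =
          E , a₀ , ρ zero , c₀ , E , suc i , b₀ , E′ , d₀ ,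
          from selInsRel (selIns chain (inj₂ (inj₁
            (y∈⇒ρ₀∈ y∈ab , e∈cd , refl , refl , refl , refl , cong suc (sym y≡i) , refl , E′≡ , refl)))) ,
          trans (wAt≡letterAt w′ E) ζ-at-e ,
          from eqRel (FactorEq-cong refl (sym y≡i) refl refl fq) ,
          from eqRel (FactorEq-cong refl refl (sym E′≡) refl fr)
        complete fe@(chain , _) | no _ | yes y∈cd with FactorEq-ins-second w i ζ y∈cd fe
        ...   | e , e∈ab@(_ , e<b) , ζ-at-e , fq , fr
                with toℕ-onto (≤toℕ⇒<1+n b₀ (<⇒≤ e<b)) | toℕ-onto (≤toℕ⇒<1+n b₀ e<b)
        ...     | E , refl | E′ , E′≡ =
          E , a₀ , E , c₀ , ρ zero , E′ , b₀ , suc i , d₀ ,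
          from selInsRel (selIns chain (inj₂ (inj₂
            (y∈⇒ρ₀∈ y∈cd , e∈ab , refl , refl , refl , refl , E′≡ , refl , cong suc (sym y≡i) , refl)))) ,
          trans (wAt≡letterAt w′ E) ζ-at-e ,
          from eqRel (FactorEq-cong refl refl refl (sym y≡i) fq) ,
          from eqRel (FactorEq-cong (sym E′≡) refl refl refl fr)
        complete fe@(chain , _) | no y∉ab | no y∉cd =
          ρ zero , a₀ , b₀ , c₀ , d₀ , a₀ , b₀ , c₀ , d₀ ,
          from selInsRel (selIns chain (inj₁
            (y∉⇒ρ₀∉ y∉ab , y∉⇒ρ₀∉ y∉cd , refl , refl , refl , refl , refl , refl , refl , refl , refl))) ,
          trans (wAt≡letterAt w′ (ρ zero)) (trans (cong (letterAt w′) y≡i) (letterAt-setAt-≡ w i (just ζ))) ,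
          from eqRel fe-before , from eqRel fe-before
          where
          fe-before : FactorEq w a b c d
          fe-before = to (FactorEq-setAt-outside w i (just ζ) y∉ab y∉cd) fe

    private
      w₀ = setAt w i nothing

    ⟦eqUpd-reset⟧ : ⟦ eqUpd resetOp ⟧ w₀ A ρ ⇔ FactorEq w₀ a b c d
    ⟦eqUpd-reset⟧ = mk⇔ sound complete
      where
      sound : ⟦ eqUpd resetOp ⟧ w₀ A ρ → FactorEq w₀ a b c d
      sound (e , q₁ , q₂ , q₃ , q₄ , r₁ , r₂ , r₃ , r₄ , sel , eq-q , eq-r) =
        FactorEq-reset-sound w i (subst (λ y → SelReset y _ _ _ _ _ _ _ _ _ _ _ _ _) y≡i (to selResetRel sel))
          (to eqRel eq-q) (to eqRel eq-r)
      complete : FactorEq w₀ a b c d → ⟦ eqUpd resetOp ⟧ w₀ A ρ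
      complete fe@(chain , _) with Y ∈[ a , b ⟩? | Y ∈[ c , d ⟩?
      ... | yes y∈ab | _ with FactorEq-reset-first w i y∈ab fe
      ...   | e , c≤e , e≤d , fq , fr with toℕ-onto (≤toℕ⇒<1+n d₀ e≤d)
      ...     | E , refl =
        E , a₀ , ρ zero , c₀ , E , suc i , b₀ , E , d₀ ,
        from selResetRel (selReset chain (inj₂ (inj₁
          (y∈⇒ρ₀∈ y∈ab , c≤e , e≤d , refl , refl , refl , refl , cong suc (sym y≡i) , refl , refl , refl)))) ,
        from eqRel (FactorEq-cong refl (sym y≡i) refl refl fq) , from eqRel fr
      complete fe@(chain , _) | no _ | yes y∈cd with FactorEq-reset-second w i y∈cd fe
      ...   | e , a≤e , e≤b , fq , fr with toℕ-onto (≤toℕ⇒<1+n b₀ e≤b)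
      ...     | E , refl =
        E , a₀ , E , c₀ , ρ zero , E , b₀ , suc i , d₀ ,
        from selResetRel (selReset chain (inj₂ (inj₂
          (y∈⇒ρ₀∈ y∈cd , a≤e , e≤b , refl , refl , refl , refl , refl , refl , cong suc (sym y≡i) , refl)))) ,
        from eqRel (FactorEq-cong refl refl refl (sym y≡i) fq) , from eqRel fr
      complete fe@(chain , _) | no y∉ab | no y∉cd =
        ρ zero , a₀ , b₀ , c₀ , d₀ , a₀ , b₀ , c₀ , d₀ ,
        from selResetRel (selReset chain (inj₁
          (y∉⇒ρ₀∉ y∉ab , y∉⇒ρ₀∉ y∉cd , refl , refl , refl , refl , refl , refl , refl , refl))) ,
        from eqRel fe-before , from eqRel fe-before
        where
        fe-before : FactorEq w a b c d
        fe-before = to (FactorEq-setAt-outside w i nothing y∉ab y∉cd) fe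

  ⟦eqUpd⟧ : ∀ {n} {w : Word s n} {A} → Invariant w A → (u : Update s n) (ρ : Fin 5 → Fin (suc n)) →
            toℕ (ρ zero) ≡ toℕ (posOf u) →
            ⟦ eqUpd (opOf u) ⟧ (applyU w u) A ρ ⇔
            FactorEq (applyU w u) (toℕ (ρ (# 1))) (toℕ (ρ (# 2))) (toℕ (ρ (# 3))) (toℕ (ρ (# 4)))
  ⟦eqUpd⟧ inv (ins ζ i) ρ y≡i = ⟦eqUpd-ins⟧ inv i ρ y≡i ζ
  ⟦eqUpd⟧ inv (reset i) ρ y≡i = ⟦eqUpd-reset⟧ inv i ρ y≡i

-- Matching a pattern

update : ∀ {X : Set} → (ℕ → Maybe X) → ℕ → X → ℕ → Maybe X
update E x v x′ with x′ ≟ x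
... | yes _ = just v
... | no _  = E x′

update-≡ : ∀ {X : Set} (E : ℕ → Maybe X) x v → update E x v x ≡ just v
update-≡ E x v with x ≟ x
... | yes _  = refl
... | no x≢x = ⊥-elim (x≢x refl)

update-≢ : ∀ {X : Set} (E : ℕ → Maybe X) x v x′ → x′ ≢ x → update E x v x′ ≡ E x′
update-≢ E x v x′ x′≢x with x′ ≟ x
... | yes x′≡x = ⊥-elim (x′≢x x′≡x)
... | no _     = refl

update-map : ∀ {X Y : Set} (f : Maybe X → Maybe Y) {E : ℕ → Maybe X} {E′ : ℕ → Maybe Y} →
             (∀ x → f (E x) ≡ E′ x) → ∀ x {v v′} → f (just v) ≡ just v′ → ∀ x′ → f (update E x v x′) ≡ update E′ x v′ x′
update-map f E≈E′ x fv≡v′ x′ with x′ ≟ x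
... | yes _ = fv≡v′
... | no _  = E≈E′ x′

-- For each variable of the pattern, the interval of its first occurrence, if any.
Bindings : Set
Bindings = ℕ → Maybe (ℕ × ℕ)

module _ {s n : ℕ} (w : Word s n) where

  Agrees : Maybe (ℕ × ℕ) → ℕ → ℕ → Set
  Agrees nothing        p q = ⊤
  Agrees (just (a , b)) p q = FactorEq w a b p q

  -- What the acceptance formula says about the suffix w[p, n) and the pattern α.
  Matches : Pattern s → ℕ → Bindings → Set
  Matches []            p E = FactorEq w p n n n
  Matches (inj₁ ζ ∷ α) p E = ∃[ e ] ∃[ q ] e < n × q ≤ n × FactorEq w p e n n × letterAt w e ≡ just ζ ×
                                            FactorEq w (suc e) q n n × Matches α q E
  Matches (inj₂ x ∷ α) p E = ∃[ q ] q ≤ n × p ≤ q × Agrees (E x) p q × Matches α q (update E x (p , q))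

  Consistent : Bindings → (ℕ → List (Fin s)) → Set
  Consistent E σ = ∀ x {a b} → E x ≡ just (a , b) → σ x ≡ factor w a b

  substOf : Bindings → ℕ → List (Fin s)
  substOf E x with E x
  ... | just (a , b) = factor w a b
  ... | nothing      = []

  substOf-consistent : ∀ E → Consistent E (substOf E)
  substOf-consistent E x Ex≡ with E x
  substOf-consistent E x refl | just _ = refl

  Agrees-just : ∀ {m a b p q} → m ≡ just (a , b) → Agrees m p q → factor w a b ≡ factor w p q
  Agrees-just refl (_ , h) = h

  Matches-sound : ∀ α p E → Matches α p E → ∃[ σ ] Consistent E σ × applySubst σ α ≡ factor w p n
  Matches-sound [] p E (_ , h) = substOf E , substOf-consistent E , sym (trans h (factor-self w n))
  Matches-sound (inj₁ ζ ∷ α) p E (e , q , e<n , q≤n , ((p≤e , _) , before) , ζ-at-e , ((e<q , _) , after) , m)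
    with Matches-sound α q E m
  ... | σ , consistent , h = σ , consistent , (begin
    ζ ∷ applySubst σ α         ≡⟨ cong (ζ ∷_) h ⟩
    [ ζ ] ++ factor w q n      ≡⟨ cong (_++ factor w q n) single ⟨
    factor w p q ++ factor w q n ≡⟨ factor-split w (≤-trans p≤e (<⇒≤ e<q)) q≤n ⟨
    factor w p n               ∎)
    where
    open ≡-Reasoning
    single : factor w p q ≡ [ ζ ]
    single = factor-letter w p≤e e<q (trans before (factor-self w n)) ζ-at-e (trans after (factor-self w n))
  Matches-sound (inj₂ x ∷ α) p E (q , q≤n , p≤q , agrees , m) with Matches-sound α q (update E x (p , q)) m
  ... | σ , consistent , h =
    σ , consistent′ , trans (cong₂ _++_ σx h) (sym (factor-split w p≤q q≤n))
    where
    σx : σ x ≡ factor w p q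
    σx = consistent x (update-≡ E x (p , q))
    consistent′ : Consistent E σ
    consistent′ z Ez with z ≟ x
    ... | yes refl = trans σx (sym (Agrees-just Ez agrees))
    ... | no z≢x   = consistent z (trans (update-≢ E x (p , q) z z≢x) Ez)

  Fits : Bindings → (ℕ → List (Fin s)) → ℕ → Set
  Fits E σ p = ∀ x {a b} → E x ≡ just (a , b) → a ≤ b × b ≤ p × σ x ≡ factor w a b

  Fits-mono : ∀ {E σ p p′} → p ≤ p′ → Fits E σ p → Fits E σ p′
  Fits-mono p≤p′ fits x Ex with fits x Ex
  ... | a≤b , b≤p , σx = a≤b , ≤-trans b≤p p≤p′ , σx

  Agrees-intro : ∀ {p q v} m → (∀ {a b} → m ≡ just (a , b) → a ≤ b × b ≤ p × v ≡ factor w a b) → p ≤ q →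
                 factor w p q ≡ v → Agrees m p q
  Agrees-intro nothing        _     _   _  = tt
  Agrees-intro (just (a , b)) bound p≤q fx with bound refl
  ... | a≤b , b≤p , v≡ = (a≤b , b≤p , p≤q) , trans (sym v≡) (sym fx)

  Matches-complete : ∀ α p E σ → p ≤ n → Fits E σ p → applySubst σ α ≡ factor w p n → Matches α p E
  Matches-complete [] p E σ p≤n fits h = (p≤n , ≤-refl , ≤-refl) , trans (sym h) (sym (factor-self w n))
  Matches-complete (inj₁ ζ ∷ α) p E σ p≤n fits h with factor-++-∷⁻ w [] ζ (applySubst σ α) p≤n (sym h)
  ... | e , p≤e , e<n , before , ζ-at-e , rest =
    e , suc e , e<n , e<n , ((p≤e , <⇒≤ e<n , ≤-refl) , trans before (sym (factor-self w n))) , ζ-at-e ,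
    ((≤-refl , e<n , ≤-refl) , trans (factor-self w (suc e)) (sym (factor-self w n))) ,
    Matches-complete α (suc e) E σ e<n (Fits-mono (≤-trans p≤e (n≤1+n e)) fits) (sym rest)
  Matches-complete (inj₂ x ∷ α) p E σ p≤n fits h with factor-++⁻ w (σ x) (applySubst σ α) p≤n (sym h)
  ... | q , p≤q , q≤n , fx , rest =
    q , q≤n , p≤q , Agrees-intro (E x) (fits x) p≤q fx ,
    Matches-complete α q (update E x (p , q)) σ q≤n fits′ (sym rest)
    where
    fits′ : Fits (update E x (p , q)) σ q
    fits′ z {a} {b} Ez = by-cases (z ≟ x)
      where
      by-cases : Dec (z ≡ x) → a ≤ b × b ≤ q × σ z ≡ factor w a b
      by-cases (no z≢x) = Fits-mono p≤q fits z (trans (sym (update-≢ E x (p , q) z z≢x)) Ez)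
      by-cases (yes refl) with trans (sym (update-≡ E x (p , q))) Ez
      ... | refl = p≤q , ≤-refl , sym fx

  Matches⇔ErasingLang : ∀ α → Matches α 0 (λ _ → nothing) ⇔ ErasingLang α (currentWord w)
  Matches⇔ErasingLang α = mk⇔
    (λ m → let σ , _ , h = Matches-sound α 0 (λ _ → nothing) m in σ , trans h (sym (currentWord≡factor w)))
    (λ (σ , h) → Matches-complete α 0 (λ _ → nothing) σ z≤n (λ _ ()) (trans h (currentWord≡factor w)))

TermBindings : ℕ → Set
TermBindings v = ℕ → Maybe (Term v × Term v)

weakenBinding : ∀ {v} → Maybe (Term v × Term v) → Maybe (Term (suc v) × Term (suc v))
weakenBinding nothing        = nothing
weakenBinding (just (a , b)) = just (weaken a , weaken b)

weakenBindings : ∀ {v} → TermBindings v → TermBindings (suc v)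
weakenBindings B x = weakenBinding (B x)

valueOf : ∀ {n v} → (Fin v → Fin (suc n)) → Maybe (Term v × Term v) → Maybe (ℕ × ℕ)
valueOf ρ nothing        = nothing
valueOf ρ (just (a , b)) = just (pos ρ a , pos ρ b)

valueOf-weaken : ∀ {n v} d (ρ : Fin v → Fin (suc n)) m → valueOf (extend d ρ) (weakenBinding m) ≡ valueOf ρ m
valueOf-weaken d ρ nothing        = refl
valueOf-weaken d ρ (just (a , b)) = cong₂ (λ a′ b′ → just (a′ , b′)) (pos-weaken d ρ a) (pos-weaken d ρ b)

weaken³ : ∀ {v} → Term v → Term (3 + v)
weaken³ t = weaken (weaken (weaken t))

module _ {s : ℕ} where

  -- EQ(a, b, c, d) in the updated structure, written over the old auxiliary relations.
  eqAfter : ∀ {v} → Op s → Term v → Term v → Term v → Term v → Term v → FO s auxArity v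
  eqAfter op y a b c d = substitute (lookupV (y ∷ a ∷ b ∷ c ∷ d ∷ [])) (eqUpd op)

  -- Without an earlier occurrence there is nothing to check; q = q stands in for "true".
  agreesF : ∀ {v} → Op s → Term v → Maybe (Term v × Term v) → Term v → Term v → FO s auxArity v
  agreesF op y nothing        p q = eq q q
  agreesF op y (just (a , b)) p q = eqAfter op y a b p q

  matchF : ∀ {v} → Op s → Pattern s → Term v → Term v → TermBindings v → FO s auxArity v
  matchF op []           y p B = eqAfter op y p dollar dollar dollar
  matchF {v} op (inj₁ ζ ∷ α) y p B =
    ex (ex (ex (and (eqAfter op (weaken³ y) (weaken³ p) e dollar dollar)
               (and (letter ζ e) (and (aux SUCC (e ∷ e+1 ∷ []))
               (and (eqAfter op (weaken³ y) e+1 q dollar dollar)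
                    (matchF op α (weaken³ y) q (weakenBindings (weakenBindings (weakenBindings B))))))))))
    where
    e e+1 q : Term (3 + v)
    e   = var (suc (suc zero))
    e+1 = var (suc zero)
    q   = var zero
  matchF op (inj₂ x ∷ α) y p B =
    ex (and (aux LE (weaken p ∷ var zero ∷ []))
       (and (agreesF op (weaken y) (weakenBinding (B x)) (weaken p) (var zero))
            (matchF op α (weaken y) (var zero) (update (weakenBindings B) x (weaken p , var zero)))))

  accF : Op s → Pattern s → FO s auxArity 1
  accF op α = ex (and (aux MIN (var zero ∷ [])) (matchF op α (var (suc zero)) (var zero) (λ _ → nothing)))

  eqAfter-CQ : ∀ {v} op (y a b c d : Term v) → IsCQ (eqAfter op y a b c d)
  eqAfter-CQ op y a b c d = substitute-CQ (lookupV (y ∷ a ∷ b ∷ c ∷ d ∷ [])) (eqUpd-CQ op)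

  agreesF-CQ : ∀ {v} op (y : Term v) m p q → IsCQ (agreesF op y m p q)
  agreesF-CQ op y nothing        p q = eq q q
  agreesF-CQ op y (just (a , b)) p q = eqAfter-CQ op y a b p q

  matchF-CQ : ∀ {v} op α (y p : Term v) B → IsCQ (matchF op α y p B)
  matchF-CQ op []           y p B = eqAfter-CQ op y p dollar dollar dollar
  matchF-CQ op (inj₁ ζ ∷ α) y p B =
    ex (ex (ex (and (eqAfter-CQ op _ _ _ _ _) (and (letter ζ _) (and (aux SUCC _)
       (and (eqAfter-CQ op _ _ _ _ _) (matchF-CQ op α _ _ _)))))))
  matchF-CQ op (inj₂ x ∷ α) y p B =
    ex (and (aux LE _) (and (agreesF-CQ op _ (weakenBinding (B x)) _ _) (matchF-CQ op α _ _ _)))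

  accF-CQ : ∀ op α → IsCQ (accF op α)
  accF-CQ op α = ex (and (aux MIN _) (matchF-CQ op α _ _ _))

  module _ {n} {w : Word s n} {A : AuxVal auxArity n} (inv : Invariant w A) (u : Update s n) where

    open Invariant inv

    private
      w′ = applyU w u
      op = opOf u

    ⟦eqAfter⟧ : ∀ {v} (ρ : Fin v → Fin (suc n)) y a b c d → pos ρ y ≡ toℕ (posOf u) →
                ⟦ eqAfter op y a b c d ⟧ w′ A ρ ⇔ FactorEq w′ (pos ρ a) (pos ρ b) (pos ρ c) (pos ρ d)
    ⟦eqAfter⟧ ρ y a b c d y≡i = ⇔.trans (⟦substitute⟧ w′ A (eqUpd op) (λ _ → refl)) (⟦eqUpd⟧ inv u _ y≡i)

    ⟦eqAfter-ε⟧ : ∀ {v} (ρ : Fin v → Fin (suc n)) y a b → pos ρ y ≡ toℕ (posOf u) →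
                  ⟦ eqAfter op y a b dollar dollar ⟧ w′ A ρ ⇔ FactorEq w′ (pos ρ a) (pos ρ b) n n
    ⟦eqAfter-ε⟧ ρ y a b y≡i =
      ⇔.trans (⟦eqAfter⟧ ρ y a b dollar dollar y≡i) (≡⇒⇔ (cong (λ k → FactorEq w′ (pos ρ a) (pos ρ b) k k) (toℕ-fromℕ n)))

    ⟦agreesF⟧ : ∀ {v} (ρ : Fin v → Fin (suc n)) y m p q → pos ρ y ≡ toℕ (posOf u) →
                ⟦ agreesF op y m p q ⟧ w′ A ρ ⇔ Agrees w′ (valueOf ρ m) (pos ρ p) (pos ρ q)
    ⟦agreesF⟧ ρ y nothing        p q y≡i = mk⇔ (λ _ → tt) (λ _ → refl)
    ⟦agreesF⟧ ρ y (just (a , b)) p q y≡i = ⟦eqAfter⟧ ρ y a b p q y≡i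

    MatchF⇔Matches : Pattern s → Set
    MatchF⇔Matches α = ∀ {v} (ρ : Fin v → Fin (suc n)) y p B E → pos ρ y ≡ toℕ (posOf u) →
                           (∀ x → valueOf ρ (B x) ≡ E x) → ⟦ matchF op α y p B ⟧ w′ A ρ ⇔ Matches w′ α (pos ρ p) E

    ⟦matchF-[]⟧ : MatchF⇔Matches []
    ⟦matchF-[]⟧ ρ y p B E y≡i _ =
      ⇔.trans (⟦eqAfter⟧ ρ y p dollar dollar dollar y≡i) (≡⇒⇔ (cong (λ k → FactorEq w′ (pos ρ p) k k k) (toℕ-fromℕ n)))

    ⟦matchF-letter⟧ : ∀ ζ α → MatchF⇔Matches α → MatchF⇔Matches (inj₁ ζ ∷ α)
    ⟦matchF-letter⟧ ζ α ⟦matchF-α⟧ {v} ρ y p B E y≡i B≈E = mk⇔ sound complete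
      where
      ρ³ : Fin (suc n) → Fin (suc n) → Fin (suc n) → Fin (3 + v) → Fin (suc n)
      ρ³ e e′ q = extend q (extend e′ (extend e ρ))

      pos-weaken³ : ∀ e e′ q t → pos (ρ³ e e′ q) (weaken³ t) ≡ pos ρ t
      pos-weaken³ e e′ q t =
        trans (pos-weaken q _ (weaken (weaken t))) (trans (pos-weaken e′ _ (weaken t)) (pos-weaken e ρ t))

      y≡i³ : ∀ e e′ q → pos (ρ³ e e′ q) (weaken³ y) ≡ toℕ (posOf u)
      y≡i³ e e′ q = trans (pos-weaken³ e e′ q y) y≡i

      IH : ∀ e e′ q → ⟦ matchF op α (weaken³ y) (var zero) (weakenBindings (weakenBindings (weakenBindings B))) ⟧ w′ A (ρ³ e e′ q) ⇔
                      Matches w′ α (toℕ q) E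
      IH e e′ q = ⟦matchF-α⟧ (ρ³ e e′ q) _ _ _ E (y≡i³ e e′ q) λ x →
        trans (valueOf-weaken q _ (weakenBinding (weakenBinding (B x))))
          (trans (valueOf-weaken e′ _ (weakenBinding (B x))) (trans (valueOf-weaken e ρ (B x)) (B≈E x)))

      sound : ⟦ matchF op (inj₁ ζ ∷ α) y p B ⟧ w′ A ρ → Matches w′ (inj₁ ζ ∷ α) (pos ρ p) E
      sound (e , e′ , q , f₁ , ζ-at-e , e′≡ , f₂ , m) =
        toℕ e , toℕ q , letterAt-just⇒< w′ (toℕ e) at-e , ≤-pred (toℕ<n q) ,
        FactorEq-cong (pos-weaken³ e e′ q p) refl refl refl (to (⟦eqAfter-ε⟧ (ρ³ e e′ q) _ (weaken³ p) _ (y≡i³ e e′ q)) f₁) ,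
        at-e ,
        FactorEq-cong (to succRel e′≡) refl refl refl (to (⟦eqAfter-ε⟧ (ρ³ e e′ q) _ (var (suc zero)) _ (y≡i³ e e′ q)) f₂) ,
        to (IH e e′ q) m
        where
        at-e : letterAt w′ (toℕ e) ≡ just ζ
        at-e = trans (sym (wAt≡letterAt w′ e)) ζ-at-e

      complete : Matches w′ (inj₁ ζ ∷ α) (pos ρ p) E → ⟦ matchF op (inj₁ ζ ∷ α) y p B ⟧ w′ A ρ
      complete (e , q , e<n , q≤n , f₁ , at-e , f₂ , m)
        with toℕ-onto {suc n} (s≤s (<⇒≤ e<n)) | toℕ-onto {suc n} (s≤s e<n) | toℕ-onto {suc n} (s≤s q≤n)
      ... | E₀ , refl | E₁ , E₁≡ | Q , refl =
        E₀ , E₁ , Q ,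
        from (⟦eqAfter-ε⟧ (ρ³ E₀ E₁ Q) _ (weaken³ p) _ (y≡i³ E₀ E₁ Q)) (FactorEq-cong (sym (pos-weaken³ E₀ E₁ Q p)) refl refl refl f₁) ,
        trans (wAt≡letterAt w′ E₀) at-e ,
        from succRel E₁≡ ,
        from (⟦eqAfter-ε⟧ (ρ³ E₀ E₁ Q) _ (var (suc zero)) _ (y≡i³ E₀ E₁ Q)) (FactorEq-cong (sym E₁≡) refl refl refl f₂) ,
        from (IH E₀ E₁ Q) m
    ⟦matchF-var⟧ : ∀ x α → MatchF⇔Matches α → MatchF⇔Matches (inj₂ x ∷ α)
    ⟦matchF-var⟧ x α ⟦matchF-α⟧ ρ y p B E y≡i B≈E = mk⇔ sound complete
      where
      y≡i′ : ∀ q → pos (extend q ρ) (weaken y) ≡ toℕ (posOf u)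
      y≡i′ q = trans (pos-weaken q ρ y) y≡i

      IH : ∀ q → ⟦ matchF op α (weaken y) (var zero) (update (weakenBindings B) x (weaken p , var zero)) ⟧ w′ A (extend q ρ) ⇔
                 Matches w′ α (toℕ q) (update E x (pos ρ p , toℕ q))
      IH q = ⟦matchF-α⟧ (extend q ρ) _ _ _ _ (y≡i′ q)
        (update-map (valueOf (extend q ρ)) (λ z → trans (valueOf-weaken q ρ (B z)) (B≈E z)) x
          (cong (λ k → just (k , toℕ q)) (pos-weaken q ρ p)))

      agrees : ∀ q → ⟦ agreesF op (weaken y) (weakenBinding (B x)) (weaken p) (var zero) ⟧ w′ A (extend q ρ) ⇔
                     Agrees w′ (E x) (pos ρ p) (toℕ q)
      agrees q = ⇔.trans (⟦agreesF⟧ (extend q ρ) _ (weakenBinding (B x)) _ (var zero) (y≡i′ q))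
        (≡⇒⇔ (cong₂ (λ m k → Agrees w′ m k (toℕ q)) (trans (valueOf-weaken q ρ (B x)) (B≈E x)) (pos-weaken q ρ p)))

      sound : ⟦ matchF op (inj₂ x ∷ α) y p B ⟧ w′ A ρ → Matches w′ (inj₂ x ∷ α) (pos ρ p) E
      sound (q , p≤q , ag , m) =
        toℕ q , ≤-pred (toℕ<n q) , subst (_≤ toℕ q) (pos-weaken q ρ p) (to leRel p≤q) , to (agrees q) ag , to (IH q) m

      complete : Matches w′ (inj₂ x ∷ α) (pos ρ p) E → ⟦ matchF op (inj₂ x ∷ α) y p B ⟧ w′ A ρ
      complete (q , q≤n , p≤q , ag , m) with toℕ-onto {suc n} (s≤s q≤n)
      ... | Q , refl =
        Q , from leRel (subst (_≤ toℕ Q) (sym (pos-weaken Q ρ p)) p≤q) , from (agrees Q) ag , from (IH Q) m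

    ⟦matchF⟧ : ∀ α → MatchF⇔Matches α
    ⟦matchF⟧ []           = ⟦matchF-[]⟧
    ⟦matchF⟧ (inj₁ ζ ∷ α) = ⟦matchF-letter⟧ ζ α (⟦matchF⟧ α)
    ⟦matchF⟧ (inj₂ x ∷ α) = ⟦matchF-var⟧ x α (⟦matchF⟧ α)

    ⟦accF⟧ : ∀ α (ρ : Fin 1 → Fin (suc n)) → toℕ (ρ zero) ≡ toℕ (posOf u) →
             ⟦ accF op α ⟧ w′ A ρ ⇔ Matches w′ α 0 (λ _ → nothing)
    ⟦accF⟧ α ρ y≡i = mk⇔
      (λ (p , p≡0 , m) → subst (λ k → Matches w′ α k (λ _ → nothing)) (to minRel p≡0) (to (IH p) m))
      (λ m → zero , from minRel refl , from (IH zero) m)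
      where
      IH : ∀ p → ⟦ matchF op α (var (suc zero)) (var zero) (λ _ → nothing) ⟧ w′ A (extend p ρ) ⇔ Matches w′ α (toℕ p) (λ _ → nothing)
      IH p = ⟦matchF⟧ α (extend p ρ) _ _ _ _ y≡i (λ _ → refl)

-- The dynamic program

module _ {s : ℕ} where

  NoTerminals : Pattern s → Set
  NoTerminals []           = ⊤
  NoTerminals (inj₁ _ ∷ _) = ⊥
  NoTerminals (inj₂ _ ∷ α) = NoTerminals α

  ErasingLang-[]⇔ : ∀ α → ErasingLang α [] ⇔ NoTerminals α
  ErasingLang-[]⇔ α = mk⇔ (λ (σ , h) → sound α σ h) (λ h → (λ _ → []) , complete α h)
    where
    sound : ∀ α σ → applySubst σ α ≡ [] → NoTerminals α
    sound []           σ h = tt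
    sound (inj₂ x ∷ α) σ h = sound α σ (++-conicalʳ (σ x) _ h)
    complete : ∀ α → NoTerminals α → applySubst (λ _ → []) α ≡ []
    complete []           _ = refl
    complete (inj₂ x ∷ α) h = complete α h

  initAcc : Pattern s → FO s noAux 0
  initAcc []           = eq dollar dollar
  initAcc (inj₁ _ ∷ _) = neg (eq dollar dollar)
  initAcc (inj₂ _ ∷ α) = initAcc α

  ⟦initAcc⟧ : ∀ α {n} (w : Word s n) ρ → ⟦ initAcc α ⟧ w (noAuxVal n) ρ ⇔ NoTerminals α
  ⟦initAcc⟧ []           w ρ = mk⇔ (λ _ → tt) (λ _ → refl)
  ⟦initAcc⟧ (inj₁ _ ∷ _) w ρ = mk⇔ (λ $≢$ → $≢$ refl) ⊥-elim
  ⟦initAcc⟧ (inj₂ _ ∷ α) w ρ = ⟦initAcc⟧ α w ρ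

  module _ (α : Pattern s) where

    initF : (r : Fin 7) → FO s noAux (auxArity r)
    initF ACC       = initAcc α
    initF EQ        = ordered (var (# 0)) (var (# 1)) (var (# 2)) (var (# 3))
    initF SEL-INS   = selInsF
    initF SEL-RESET = selResetF
    initF SUCC      = succ (var (# 0)) (var (# 1))
    initF MIN       = min (var (# 0))
    initF LE        = le (var (# 0)) (var (# 1))

    -- The relations other than ACC and EQ are static: their update formula copies them.
    updF : (r : Fin 7) → Op s → FO s auxArity (suc (auxArity r))
    updF ACC       op = accF op α
    updF EQ        op = eqUpd op
    updF SEL-INS   op = aux SEL-INS (tabulate (var ∘ suc))
    updF SEL-RESET op = aux SEL-RESET (tabulate (var ∘ suc))
    updF SUCC      op = aux SUCC (tabulate (var ∘ suc))
    updF MIN       op = aux MIN (tabulate (var ∘ suc))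
    updF LE        op = aux LE (tabulate (var ∘ suc))

    program : DynProgram s
    program = record { m = 7 ; arity = auxArity ; init = initF ; upd = updF ; acc = ACC ; accAr = refl }

    program-CQ : IsDynCQ program
    program-CQ ACC       op = accF-CQ op α
    program-CQ EQ        op = eqUpd-CQ op
    program-CQ SEL-INS   op = aux _ _
    program-CQ SEL-RESET op = aux _ _
    program-CQ SUCC      op = aux _ _
    program-CQ MIN       op = aux _ _
    program-CQ LE        op = aux _ _

    Invariant-init : ∀ n → Invariant (proj₁ (initState program n)) (proj₂ (initState program n))
    Invariant-init n = record
      { eqRel       = λ {a b c d} →
          ⇔.trans (⟦ordered⟧ w₀ A₀ (lookupV (a ∷ b ∷ c ∷ d ∷ [])) (var (# 0)) (var (# 1)) (var (# 2)) (var (# 3)))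
                  (mk⇔ (λ chain → chain , trans (factor-empty {n = n} (toℕ a) (toℕ b)) (sym (factor-empty {n = n} (toℕ c) (toℕ d))))
                       proj₁)
      ; selInsRel   = λ {y a b c d e q₁ q₂ q₃ q₄ r₁ r₂ r₃ r₄} →
          ⟦selIns⟧ w₀ (lookupV (y ∷ a ∷ b ∷ c ∷ d ∷ e ∷ q₁ ∷ q₂ ∷ q₃ ∷ q₄ ∷ r₁ ∷ r₂ ∷ r₃ ∷ r₄ ∷ []))
      ; selResetRel = λ {y a b c d e q₁ q₂ q₃ q₄ r₁ r₂ r₃ r₄} →
          ⟦selReset⟧ w₀ (lookupV (y ∷ a ∷ b ∷ c ∷ d ∷ e ∷ q₁ ∷ q₂ ∷ q₃ ∷ q₄ ∷ r₁ ∷ r₂ ∷ r₃ ∷ r₄ ∷ []))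
      ; succRel     = λ {a b} → ⟦succ⟧ w₀ A₀ (lookupV (a ∷ b ∷ [])) (var (# 0)) (var (# 1))
      ; minRel      = λ {a} → ⟦min⟧ w₀ A₀ (lookupV (a ∷ [])) (var (# 0))
      ; leRel       = λ {a b} → ⟦le⟧ w₀ A₀ (lookupV (a ∷ b ∷ [])) (var (# 0)) (var (# 1))
      }
      where
      w₀ = emptyWord program n
      A₀ = noAuxVal n

    Invariant-step : ∀ {n} {st : State program n} → Invariant (proj₁ st) (proj₂ st) → (u : Update s n) →
                     Invariant (proj₁ (step program st u)) (proj₂ (step program st u))
    Invariant-step inv u = record
      { eqRel       = λ {a b c d} → ⟦eqUpd⟧ inv u (lookupV (inject₁ (posOf u) ∷ a ∷ b ∷ c ∷ d ∷ [])) (toℕ-inject₁ (posOf u))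
      ; selInsRel   = selInsRel
      ; selResetRel = selResetRel
      ; succRel     = succRel
      ; minRel      = minRel
      ; leRel       = leRel
      }
      where open Invariant inv

    Reachable⇒Invariant : ∀ {n} {st : State program n} → Reachable program st → Invariant (proj₁ st) (proj₂ st)
    Reachable⇒Invariant {n} start       = Invariant-init n
    Reachable⇒Invariant (next u reach _) = Invariant-step (Reachable⇒Invariant reach) u

    program-maintains : Maintains program (ErasingLang α)
    program-maintains n _ start = ⇔.trans (⟦initAcc⟧ α w₀ (lookupV [])) (⇔.trans (⇔.sym (ErasingLang-[]⇔ α))
      (≡⇒⇔ (cong (ErasingLang α) (sym (trans (currentWord≡factor w₀) (factor-empty {n = n} 0 n))))))
      where
      w₀ = emptyWord program n
    program-maintains n _ (next {st} u reach _) =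
      ⇔.trans (⟦accF⟧ (Reachable⇒Invariant reach) u α (lookupV (inject₁ (posOf u) ∷ [])) (toℕ-inject₁ (posOf u))) (Matches⇔ErasingLang (applyU (proj₁ st) u) α)

corollary3p11 : (s : ℕ) (α : Pattern s) → MaintainableInDynCQ (ErasingLang α)
corollary3p11 s α = program α , program-CQ α , program-maintains α
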